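{- Let $n,k\geq 1$. For every forest $F\in\widehat{\mathcal{F}}^*_n(k)$ and every subset $S\subseteq\mathrm{Oint}(F)$, the forest $F'=\Phi_S(F)$ belongs to $\widehat{\mathcal{F}}_n(k)$ and satisfies $\mathrm{rleaf}(F')=0$, $\mathrm{Si}^*(F')=\mathrm{Si}^*(F)$, and $\mathrm{lleaf}(F')-\mathrm{si}(F')=\mathrm{lleaf}(F)-\mathrm{si}(F)+|S|$.
   Context: Trees: all trees are ordered (plane) rooted trees; the level of a node is its distance from the root (root at level 0); a leaf is a node with no children. An even $k$-ary tree is an ordered tree in which every node on an even level has exactly $k$ children. A pruned even $k$-ary tree is obtained from an even $k$-ary tree by deleting, for every even-level node all of whose children are leaves, all those children. An increasing pruned even $k$-ary tree on a set $M$ of positive integers is a pruned even $k$-ary tree whose nodes on even levels are labeled bijectively by $M$ (odd-level nodes unlabeled) such that labels increase along every path from the root downward and, for each node, the labels of its children increase from left to right. $\mathcal{F}_n(k)$ is the set of sequences $F=(T_1,\dots,T_m)$ of such trees whose label sets partition $[n]$ and whose root labels increase left to right. A labeled node is a leaf if it has no children and internal otherwise; $\mathrm{lleaf}(F)$ is the number of labeled leaves of $F$. A singleton is a one-node tree; $\mathrm{si}(F)$ is the number of singletons, $\mathrm{Si}(F)$ the set of their labels. For a labeled node $v$, its grand parent is the labeled node $u$ such that a child of $u$ is the parent of $v$. A labeled non-root node is old if its label is the greatest among all grand children of its grand parent, and young otherwise; roots are neither. $\mathrm{Oint}(F)$ is the set of labels of old internal nodes of $F$, $\mathrm{Yleaf}(F)$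 the set of labels of young leaves. $\Phi_x$ on a tree $T$ (for a label $x$ of node $v$): (i) if $v$ is old internal, with grand parent $u$, children $\mu_1..\mu_k$ of $u$ and children $\nu_1..\nu_k$ of $v$ (left to right), delete each $\nu_j$ and attach the subtrees rooted at children of $\nu_j$ to $\mu_j$, ordering children of $\mu_j$ increasingly; (ii) if $v$ is a young leaf, with grand parent $u$ and children $\mu_1..\mu_k$ of $u$, let $F_j$ be the subtrees of $\mu_j$ whose root labels exceed $x$; attach $k$ new unlabeled children $\nu_1..\nu_k$ to $v$ and move the subtrees in $F_j$ to $\nu_j$, ordering increasingly; (iii) otherwise $\Phi_x(T)=T$. For a set $S$ of labels of $T$, $\Phi_S(T)$ is the composition of the $\Phi_x$, $x\in S$ (these commute when $S\subseteq\mathrm{Oint}(T)$ or $S\subseteq\mathrm{Yleaf}(T)$). For $F=(T_1,\dots,T_m)$ and $S\subseteq\mathrm{Oint}(F)$ or $S\subseteq\mathrm{Yleaf}(F)$, $\Phi_S(F)=(\Phi_{S_1}(T_1),\dots,\Phi_{S_m}(T_m))$ where $S_i$ is the set of elements of $S$ labeling nodes of $T_i$. Removable leaves of $F=(T_1,\dots,T_m)$: an old leaf $u$ of $T_i$ is removable if $u$ is a grand child of the root of $T_i$ and the only leaf among the grand children of that root, the first $k-1$ children of the root of $T_i$ are leaves, and (if $i<m$) the label of $u$ is smaller than the root label of $T_{i+1}$. A young leaf $u\in T_m$ with label $x$ is removable if $u$ is a grand child of the root of $T_m$ and the first $k-1$ children of the root of $\Phi_x(T_m)$ are leaves. $\mathrm{rleaf}(F)$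 is the total number of removable old and removable young leaves. $\overline{\mathcal{F}}_n(k)$ is the set of $F\in\mathcal{F}_n(k)$ whose rightmost tree is a singleton or has the first $k-1$ children of its root being leaves; $\widehat{\mathcal{F}}_n(k)=\mathcal{F}_n(k)\setminus\overline{\mathcal{F}}_n(k)$. $\widehat{\mathcal{F}}^*_n(k)=\{F\in\widehat{\mathcal{F}}_n(k): F \text{ has no young leaves}, \mathrm{rleaf}(F)=0\}$. $\mathrm{Si}^*(F)$ is $\mathrm{Si}(F)$ minus the label of $T_m$ if $T_m$ is a singleton (otherwise $\mathrm{Si}^*(F)=\mathrm{Si}(F)$). -}

module Defs where

open import Data.Nat using (ℕ; zero; suc; _+_; _⊔_; _≡ᵇ_; _<ᵇ_; _≤ᵇ_)
open import Data.Bool using (Bool; true; false; _∧_; _∨_; not; if_then_else_; T)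
open import Data.List using (List; []; _∷_; map; concat; filter; _++_; length; zipWith; take; foldr; upTo; null)
open import Data.Bool.ListAction using (and; or)
open import Data.Nat.ListAction using (sum)
open import Data.Maybe using (Maybe; just; nothing)
open import Data.Product using (_×_)
open import Data.Empty using (⊥)
open import Relation.Nullary using (¬_)
open import Relation.Binary.PropositionalEquality using (_≡_)
open import Data.List.Relation.Binary.Permutation.Propositional using (_↭_)

-- A labeled (even-level) node with label x and its list of unlabeled
-- (odd-level) children; each odd-level child is represented by the list
-- of its own (labeled, even-level) children, left to right.

data Tree : Set where
  node : ℕ → List (List Tree) → Tree

Forest : Set
Forest = List Tree

root : Tree → ℕ
root (node x _) = x

kids : Tree → List (List Tree)
kids (node _ cs) = cs

isLeaf : Tree → Bool
isLeaf (node _ []) = true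
isLeaf (node _ (_ ∷ _)) = false

-- maximum of a list of naturals (labels are positive, so 0 is neutral)
maxL : List ℕ → ℕ
maxL = foldr _⊔_ 0

grandLabels : List (List Tree) → List ℕ
grandLabels cs = map root (concat cs)

mutual
  labelsT : Tree → List ℕ
  labelsT (node x cs) = x ∷ labelsLL cs

  labelsLL : List (List Tree) → List ℕ
  labelsLL [] = []
  labelsLL (c ∷ cs) = labelsL c ++ labelsLL cs

  labelsL : List Tree → List ℕ
  labelsL [] = []
  labelsL (t ∷ ts) = labelsT t ++ labelsL ts

labelsF : Forest → List ℕ
labelsF [] = []
labelsF (t ∷ ts) = labelsT t ++ labelsF ts

increasing : List ℕ → Bool
increasing [] = true
increasing (x ∷ []) = true
increasing (x ∷ y ∷ ys) = (x <ᵇ y) ∧ increasing (y ∷ ys)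

-- pruned shape: a labeled node has no children, or exactly k children
-- not all of which are leaves
prunedShape : ℕ → List (List Tree) → Bool
prunedShape k [] = true
prunedShape k cs@(_ ∷ _) = (length cs ≡ᵇ k) ∧ or (map (λ c → not (null c)) cs)

mutual
  okT : ℕ → Tree → Bool
  okT k (node x cs) = prunedShape k cs ∧ okLL k x cs

  okLL : ℕ → ℕ → List (List Tree) → Bool
  okLL k x [] = true
  okLL k x (c ∷ cs) = increasing (map root c) ∧ okL k x c ∧ okLL k x cs

  okL : ℕ → ℕ → List Tree → Bool
  okL k x [] = true
  okL k x (t ∷ ts) = (x <ᵇ root t) ∧ okT k t ∧ okL k x ts

InF : ℕ → ℕ → Forest → Set
InF n k F = T (and (map (okT k) F)) × T (increasing (map root F))
          × (labelsF F ↭ map suc (upTo n))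

mutual
  lleafT : Tree → ℕ
  lleafT (node x []) = 1
  lleafT (node x cs@(_ ∷ _)) = lleafLL cs

  lleafLL : List (List Tree) → ℕ
  lleafLL [] = 0
  lleafLL (c ∷ cs) = lleafL c + lleafLL cs

  lleafL : List Tree → ℕ
  lleafL [] = 0
  lleafL (t ∷ ts) = lleafT t + lleafL ts

lleaf : Forest → ℕ
lleaf F = sum (map lleafT F)

si : Forest → ℕ
si F = length (filter (λ t → T? (isLeaf t)) F)
  where
  open import Relation.Nullary.Decidable using (Dec)
  open import Data.Bool.Properties using (T?)

Si : Forest → List ℕ
Si F = map root (filter (λ t → T? (isLeaf t)) F)
  where
  open import Data.Bool.Properties using (T?)

lastT : Forest → Maybe Tree
lastT [] = nothing
lastT (t ∷ []) = just t
lastT (_ ∷ t ∷ ts) = lastT (t ∷ ts)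

SiStar : Forest → List ℕ
SiStar F with lastT F
... | nothing = Si F
... | just (node y []) = filter (λ z → T? (not (z ≡ᵇ y))) (Si F)
  where open import Data.Bool.Properties using (T?)
... | just (node y (_ ∷ _)) = Si F

-- Old / young nodes.  A grand child g of a labeled node whose grand
-- children have labels gl is old iff root g is the maximum of gl.

mutual
  ointT : Tree → List ℕ
  ointT (node x cs) = ointLL (maxL (grandLabels cs)) cs

  ointLL : ℕ → List (List Tree) → List ℕ
  ointLL m [] = []
  ointLL m (c ∷ cs) = ointL m c ++ ointLL m cs

  ointL : ℕ → List Tree → List ℕ
  ointL m [] = []
  ointL m (t ∷ ts) =
    (if (root t ≡ᵇ m) ∧ not (isLeaf t) then root t ∷ [] else [])
    ++ ointT t ++ ointL m ts

Oint : Forest → List ℕ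
Oint F = concat (map ointT F)

mutual
  yleafT : Tree → List ℕ
  yleafT (node x cs) = yleafLL (maxL (grandLabels cs)) cs

  yleafLL : ℕ → List (List Tree) → List ℕ
  yleafLL m [] = []
  yleafLL m (c ∷ cs) = yleafL m c ++ yleafLL m cs

  yleafL : ℕ → List Tree → List ℕ
  yleafL m [] = []
  yleafL m (t ∷ ts) =
    (if not (root t ≡ᵇ m) ∧ isLeaf t then root t ∷ [] else [])
    ++ yleafT t ++ yleafL m ts

Yleaf : Forest → List ℕ
Yleaf F = concat (map yleafT F)

insertR : Tree → List Tree → List Tree
insertR t [] = t ∷ []
insertR t (u ∷ us) = if root t ≤ᵇ root u then t ∷ u ∷ us else u ∷ insertR t us

sortR : List Tree → List Tree
sortR = foldr insertR []

findR : ℕ → List Tree → Maybe Tree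
findR x [] = nothing
findR x (t ∷ ts) = if root t ≡ᵇ x then just t else findR x ts

-- case (i): v (label x) old internal with children ds = ν_1..ν_k;
-- cs = μ_1..μ_k are the children of the grand parent u
stepOld : ℕ → List (List Tree) → List (List Tree) → List (List Tree)
stepOld x cs ds =
  zipWith (λ μ ν → sortR (map (λ t → if root t ≡ᵇ x then node x [] else t) μ
                          ++ ν))
          cs ds

-- case (ii): v (label x) young leaf; cs = μ_1..μ_k children of u
stepYoung : ℕ → List (List Tree) → List (List Tree)
stepYoung x cs =
  map (λ μ → map (λ t → if root t ≡ᵇ x then newV else t)
                 (filter (λ t → T? (root t ≤ᵇ x)) μ)) cs
  where
  open import Data.Bool.Properties using (T?)
  newV : Tree
  newV = node x (map (λ μ → sortR (filter (λ t → T? (x <ᵇ root t)) μ)) cs)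

mutual
  Φ : ℕ → Tree → Tree
  Φ x (node y cs) with findR x (concat cs)
  ... | just (node _ []) =
        if x ≡ᵇ maxL (grandLabels cs) then node y cs
        else node y (stepYoung x cs)
  ... | just (node _ ds@(_ ∷ _)) =
        if x ≡ᵇ maxL (grandLabels cs) then node y (stepOld x cs ds)
        else node y cs
  ... | nothing = node y (ΦLL x cs)

  ΦLL : ℕ → List (List Tree) → List (List Tree)
  ΦLL x [] = []
  ΦLL x (c ∷ cs) = ΦL x c ∷ ΦLL x cs

  ΦL : ℕ → List Tree → List Tree
  ΦL x [] = []
  ΦL x (t ∷ ts) = Φ x t ∷ ΦL x ts

ΦF : ℕ → Forest → Forest
ΦF x F = map (Φ x) F

ΦS : List ℕ → Forest → Forest
ΦS S F = foldr ΦF F S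

firstLeaves : ℕ → Tree → Bool
firstLeaves k t = and (map null (take (k Data.Nat.∸ 1) (kids t)))

-- number of removable old leaves of a tree T_i; nxt is the root label of
-- T_{i+1} if i < m
rOldT : ℕ → Maybe ℕ → Tree → ℕ
rOldT k nxt t with filter (λ g → T? (isLeaf g)) (concat (kids t))
  where open import Data.Bool.Properties using (T?)
... | u ∷ [] =
  if (root u ≡ᵇ maxL (grandLabels (kids t))) ∧ firstLeaves k t ∧ nxtOK (root u) nxt
  then 1 else 0
  where
  nxtOK : ℕ → Maybe ℕ → Bool
  nxtOK a nothing = true
  nxtOK a (just b) = a <ᵇ b
... | _ = 0

rOld : ℕ → Forest → ℕ
rOld k [] = 0
rOld k (t ∷ []) = rOldT k nothing t
rOld k (t ∷ t' ∷ ts) = rOldT k (just (root t')) t + rOld k (t' ∷ ts)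

rYoungT : ℕ → Tree → ℕ
rYoungT k t =
  length (filter (λ g → T? (isLeaf g ∧ not (root g ≡ᵇ maxL (grandLabels (kids t)))
                              ∧ firstLeaves k (Φ (root g) t)))
                 (concat (kids t)))
  where open import Data.Bool.Properties using (T?)

rYoung : ℕ → Forest → ℕ
rYoung k F with lastT F
... | nothing = 0
... | just t = rYoungT k t

rleaf : ℕ → Forest → ℕ
rleaf k F = rOld k F + rYoung k F

barCond : ℕ → Forest → Bool
barCond k F with lastT F
... | nothing = false
... | just t = isLeaf t ∨ firstLeaves k t

InFbar : ℕ → ℕ → Forest → Set
InFbar n k F = InF n k F × T (barCond k F)

InFhat : ℕ → ℕ → Forest → Set
InFhat n k F = InF n k F × ¬ T (barCond k F)

InFhatStar : ℕ → ℕ → Forest → Set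
InFhatStar n k F = InFhat n k F × Yleaf F ≡ [] × rleaf k F ≡ 0

-- For an old internal node x with grand parent u, Φ_x moves the grand children of x
-- into the corresponding children of u (keeping them sorted) and leaves x as a leaf.
-- All those grand children exceed x, so the maximum among the grand children of u is
-- now one of them: x turns into a young leaf and every other old internal node stays
-- old internal, which lets the elements of S be applied one at a time. Each step
-- permutes the labels, adds exactly one labelled leaf and touches no singleton.
-- For the removable leaves two invariants of the roots survive every step: each tree
-- has no removable old leaf or has a young grand child of its root (which rules one
-- out), and the last tree has a grand child e of its root, inside the first k − 1
-- children, that lies below every young leaf at that level. Since Φ_y for a young
-- leaf y keeps every subtree with root label ≤ y, the witness e keeps the first k − 1
-- children of the last root non-empty, before and after any such Φ_y; this is both
-- the failure of the bar condition and the absence of removable young leaves.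
module Submission where

module Contraction where

  open import Defs
  open import Data.Nat using (ℕ; suc; _+_; _⊔_; _≡ᵇ_; _<ᵇ_; _≤ᵇ_; _≤_; _<_; _∸_; s≤s)
  open import Data.Nat.Properties
  open import Data.Nat.ListAction using (sum)
  open import Data.Nat.ListAction.Properties using (sum-++; sum-↭)
  open import Data.Bool using (Bool; true; false; _∧_; _∨_; not; if_then_else_; T)
  open import Data.Bool.Properties using (T?)
  open import Data.Bool.ListAction using (and; or)
  open import Data.List using (List; []; _∷_; map; concat; filter; _++_; length; zipWith; take; null)
  open import Data.List.Properties
    using (map-++; ++-assoc; concat-map; length-map; ++-identityʳ; take-map; ++-conicalˡ; ++-conicalʳ)
  open import Data.List.Membership.Propositional using (_∈_; _∉_)
  open import Data.List.Membership.Propositional.Properties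
    using (∈-++⁺ˡ; ∈-++⁺ʳ; ∈-++⁻; ∈-map⁺; ∈-map⁻; ∈-filter⁺; ∈-∃++)
  open import Data.List.Membership.DecPropositional _≟_ using (_∈?_)
  open import Data.List.Relation.Unary.Any using (here; there)
  open import Data.List.Relation.Unary.Any.Properties using (¬Any[])
  open import Data.List.Relation.Unary.All using (All; []; _∷_)
  import Data.List.Relation.Unary.All as All
  import Data.List.Relation.Unary.All.Properties as All
  open import Data.List.Relation.Unary.AllPairs using (AllPairs; []; _∷_)
  open import Data.List.Relation.Unary.Unique.Propositional using (Unique)
  import Data.List.Relation.Unary.Unique.Propositional.Properties as Unique
  open import Data.List.Relation.Binary.Permutation.Propositional
    using (_↭_; ↭-refl; ↭-sym; ↭-trans; ↭-prep; ↭⇒↭ₛ)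
  import Data.List.Relation.Binary.Permutation.Propositional as Perm
  import Data.List.Relation.Binary.Permutation.Propositional.Properties as Perm
  import Data.List.Relation.Binary.Permutation.Setoid.Properties as PermSetoid
  open import Data.Maybe using (Maybe; just; nothing)
  import Data.Maybe as Maybe
  import Data.Integer as ℤ
  import Data.Integer.Properties as ℤ
  open import Function using (_∘_)
  open import Data.Product using (_×_; _,_; proj₁; proj₂; ∃)
  open import Data.Sum using (_⊎_; inj₁; inj₂)
  open import Data.Empty using (⊥; ⊥-elim)
  open import Data.Unit using (⊤; tt)
  open import Relation.Nullary using (¬_; yes; no)
  open import Relation.Binary.PropositionalEquality

  T-∧⁺ : ∀ {a b} → T a → T b → T (a ∧ b)
  T-∧⁺ {true} {true} _ _ = tt

  T-∧⁻ˡ : ∀ a {b} → T (a ∧ b) → T a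
  T-∧⁻ˡ true _ = tt

  T-∧⁻ʳ : ∀ a {b} → T (a ∧ b) → T b
  T-∧⁻ʳ true p = p

  T-∧-not⁻ : ∀ a b → T (a ∧ not b) → T a × b ≡ false
  T-∧-not⁻ true false _ = tt , refl

  ¬T-∨⁻ : ∀ a b → ¬ T (a ∨ b) → a ≡ false × b ≡ false
  ¬T-∨⁻ false false _ = refl , refl
  ¬T-∨⁻ true b n = ⊥-elim (n tt)
  ¬T-∨⁻ false true n = ⊥-elim (n tt)

  ≡ᵇ-true⇒≡ : ∀ {m n} → (m ≡ᵇ n) ≡ true → m ≡ n
  ≡ᵇ-true⇒≡ {m} {n} e = ≡ᵇ⇒≡ m n (subst T (sym e) tt)

  ≡ᵇ-false⇒≢ : ∀ {m n} → (m ≡ᵇ n) ≡ false → m ≢ n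
  ≡ᵇ-false⇒≢ {m} e refl = subst T e (≡⇒≡ᵇ m m refl)

  ≡⇒≡ᵇ-true : ∀ {m n} → m ≡ n → (m ≡ᵇ n) ≡ true
  ≡⇒≡ᵇ-true {m} {n} e with m ≡ᵇ n in q
  ... | true = refl
  ... | false = ⊥-elim (≡ᵇ-false⇒≢ q e)

  ≢⇒≡ᵇ-false : ∀ {m n} → m ≢ n → (m ≡ᵇ n) ≡ false
  ≢⇒≡ᵇ-false {m} {n} ne with m ≡ᵇ n in e
  ... | true = ⊥-elim (ne (≡ᵇ-true⇒≡ e))
  ... | false = refl

  ≤⇒≤ᵇ-true : ∀ {m n} → m ≤ n → (m ≤ᵇ n) ≡ true
  ≤⇒≤ᵇ-true {m} {n} le with m ≤ᵇ n in e
  ... | true = refl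
  ... | false = ⊥-elim (subst T e (≤⇒≤ᵇ le))

  <ᵇ-trans : ∀ {a b c} → T (a <ᵇ b) → T (b <ᵇ c) → T (a <ᵇ c)
  <ᵇ-trans {a} {b} {c} p q = <⇒<ᵇ (<-trans (<ᵇ⇒< a b p) (<ᵇ⇒< b c q))

  ∈-if-[_]⁻ : ∀ b {w z : ℕ} → z ∈ (if b then w ∷ [] else []) → T b × z ≡ w
  ∈-if-[ true ]⁻ (here refl) = tt , refl

  Unique-++⁻ : ∀ {A : Set} (xs : List A) {ys} → Unique (xs ++ ys) →
    Unique xs × Unique ys × (∀ {z} → z ∈ xs → z ∈ ys → ⊥)
  Unique-++⁻ [] u = [] , u , λ ()
  Unique-++⁻ (x ∷ xs) (x∉ ∷ u) with Unique-++⁻ xs u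
  ... | uxs , uys , disjoint =
    All.++⁻ˡ xs x∉ ∷ uxs , uys , λ { (here refl) z∈ys → All.lookup (All.++⁻ʳ xs x∉) z∈ys refl
                                   ; (there z∈xs) z∈ys → disjoint z∈xs z∈ys }

  Unique-resp-↭ : ∀ {A : Set} {xs ys : List A} → xs ↭ ys → Unique xs → Unique ys
  Unique-resp-↭ {A} p = PermSetoid.Unique-resp-↭ (setoid A) (↭⇒↭ₛ p)

  maxL-++ : ∀ a b → maxL (a ++ b) ≡ maxL a ⊔ maxL b
  maxL-++ [] b = refl
  maxL-++ (x ∷ a) b = trans (cong (x ⊔_) (maxL-++ a b)) (sym (⊔-assoc x (maxL a) (maxL b)))

  maxL-↭ : ∀ {a b} → a ↭ b → maxL a ≡ maxL b
  maxL-↭ p = PermSetoid.foldr-commMonoid (setoid ℕ) ⊔-0-isCommutativeMonoid (↭⇒↭ₛ p)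

  ≤-maxL : ∀ {z l} → z ∈ l → z ≤ maxL l
  ≤-maxL {l = x ∷ l} (here refl) = m≤m⊔n x (maxL l)
  ≤-maxL {l = x ∷ l} (there m) = ≤-trans (≤-maxL m) (m≤n⊔m x (maxL l))

  Every : (Tree → Set) → List Tree → Set
  Every P ts = ∀ {g} → g ∈ ts → P g

  Every-++ : ∀ {P : Tree → Set} a {b} → Every P a → Every P b → Every P (a ++ b)
  Every-++ a pa pb m with ∈-++⁻ a m
  ... | inj₁ p = pa p
  ... | inj₂ p = pb p

  root∈labelsT : ∀ t → root t ∈ labelsT t
  root∈labelsT (node _ _) = here refl

  kids⊆labelsT : ∀ t {z} → z ∈ labelsLL (kids t) → z ∈ labelsT t
  kids⊆labelsT (node _ _) m = there m

  labelsL-++ : ∀ a b → labelsL (a ++ b) ≡ labelsL a ++ labelsL b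
  labelsL-++ [] b = refl
  labelsL-++ (t ∷ a) b =
    trans (cong (labelsT t ++_) (labelsL-++ a b)) (sym (++-assoc (labelsT t) (labelsL a) (labelsL b)))

  labelsLL-concat : ∀ cs → labelsLL cs ≡ labelsL (concat cs)
  labelsLL-concat [] = refl
  labelsLL-concat (c ∷ cs) =
    trans (cong (labelsL c ++_) (labelsLL-concat cs)) (sym (labelsL-++ c (concat cs)))

  labelsF≡labelsL : ∀ F → labelsF F ≡ labelsL F
  labelsF≡labelsL [] = refl
  labelsF≡labelsL (t ∷ F) = cong (labelsT t ++_) (labelsF≡labelsL F)

  labelsL-↭ : ∀ {a b} → a ↭ b → labelsL a ↭ labelsL b
  labelsL-↭ Perm.refl = ↭-refl
  labelsL-↭ (Perm.prep t p) = Perm.++⁺ˡ (labelsT t) (labelsL-↭ p)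
  labelsL-↭ (Perm.swap s t p) = ↭-trans (Perm.shifts (labelsT s) (labelsT t))
    (Perm.++⁺ˡ (labelsT t) (Perm.++⁺ˡ (labelsT s) (labelsL-↭ p)))
  labelsL-↭ (Perm.trans p q) = ↭-trans (labelsL-↭ p) (labelsL-↭ q)

  labelsL-map-↭ : ∀ (f : Tree → Tree) ts → Every (λ t → labelsT (f t) ↭ labelsT t) ts →
    labelsL (map f ts) ↭ labelsL ts
  labelsL-map-↭ f [] h = ↭-refl
  labelsL-map-↭ f (t ∷ ts) h = Perm.++⁺ (h (here refl)) (labelsL-map-↭ f ts (λ m → h (there m)))

  ∈-labelsL⁺ : ∀ {g ts z} → g ∈ ts → z ∈ labelsT g → z ∈ labelsL ts
  ∈-labelsL⁺ {ts = t ∷ ts} (here refl) m = ∈-++⁺ˡ m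
  ∈-labelsL⁺ {ts = t ∷ ts} (there g∈) m = ∈-++⁺ʳ (labelsT t) (∈-labelsL⁺ g∈ m)

  ∈-labelsL⁻ : ∀ ts {z} → z ∈ labelsL ts → ∃ λ g → g ∈ ts × z ∈ labelsT g
  ∈-labelsL⁻ (t ∷ ts) m with ∈-++⁻ (labelsT t) m
  ... | inj₁ p = t , here refl , p
  ... | inj₂ p with ∈-labelsL⁻ ts p
  ...   | g , g∈ , q = g , there g∈ , q

  ∈-labelsLL⁺ : ∀ {g cs z} → g ∈ concat cs → z ∈ labelsT g → z ∈ labelsLL cs
  ∈-labelsLL⁺ {cs = cs} g∈ m = subst (_ ∈_) (sym (labelsLL-concat cs)) (∈-labelsL⁺ g∈ m)

  lleafL≡lleaf : ∀ ts → lleafL ts ≡ lleaf ts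
  lleafL≡lleaf [] = refl
  lleafL≡lleaf (t ∷ ts) = cong (lleafT t +_) (lleafL≡lleaf ts)

  lleafL-++ : ∀ a b → lleafL (a ++ b) ≡ lleafL a + lleafL b
  lleafL-++ a b = begin
    lleafL (a ++ b)                 ≡⟨ lleafL≡lleaf (a ++ b) ⟩
    sum (map lleafT (a ++ b))       ≡⟨ cong sum (map-++ lleafT a b) ⟩
    sum (map lleafT a ++ map lleafT b) ≡⟨ sum-++ (map lleafT a) (map lleafT b) ⟩
    lleaf a + lleaf b               ≡⟨ sym (cong₂ _+_ (lleafL≡lleaf a) (lleafL≡lleaf b)) ⟩
    lleafL a + lleafL b             ∎
    where open ≡-Reasoning

  lleafL-↭ : ∀ {a b} → a ↭ b → lleafL a ≡ lleafL b
  lleafL-↭ {a} {b} p =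
    trans (lleafL≡lleaf a) (trans (sum-↭ (Perm.map⁺ lleafT p)) (sym (lleafL≡lleaf b)))

  lleafLL-concat : ∀ cs → lleafLL cs ≡ lleafL (concat cs)
  lleafLL-concat [] = refl
  lleafLL-concat (c ∷ cs) = trans (cong (lleafL c +_) (lleafLL-concat cs)) (sym (lleafL-++ c (concat cs)))

  findR-just⁻ : ∀ x ts {h} → findR x ts ≡ just h → h ∈ ts × root h ≡ x
  findR-just⁻ x (t ∷ ts) eq with root t ≡ᵇ x in e
  findR-just⁻ x (t ∷ ts) refl | true = here refl , ≡ᵇ-true⇒≡ e
  ... | false with findR-just⁻ x ts eq
  ...   | h∈ , r = there h∈ , r

  findR-nothing⁻ : ∀ x ts → findR x ts ≡ nothing → ∀ {g} → g ∈ ts → root g ≢ x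
  findR-nothing⁻ x (t ∷ ts) eq g∈ with root t ≡ᵇ x in e
  findR-nothing⁻ x (t ∷ ts) () g∈ | true
  findR-nothing⁻ x (t ∷ ts) eq (here refl) | false = ≡ᵇ-false⇒≢ e
  findR-nothing⁻ x (t ∷ ts) eq (there g∈ts) | false = findR-nothing⁻ x ts eq g∈ts

  findR-root : ∀ ts {g} → Unique (map root ts) → g ∈ ts → findR (root g) ts ≡ just g
  findR-root (t ∷ ts) u (here refl) rewrite ≡⇒≡ᵇ-true {root t} refl = refl
  findR-root (t ∷ ts) {g} (t∉ ∷ u) (there g∈) with root t ≡ᵇ root g in e
  ... | true = ⊥-elim (All.lookup t∉ (∈-map⁺ root g∈) (≡ᵇ-true⇒≡ e))
  ... | false = findR-root ts u g∈

  ΦL≡map : ∀ x ts → ΦL x ts ≡ map (Φ x) ts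
  ΦL≡map x [] = refl
  ΦL≡map x (t ∷ ts) = cong (Φ x t ∷_) (ΦL≡map x ts)

  ΦLL≡map : ∀ x cs → ΦLL x cs ≡ map (map (Φ x)) cs
  ΦLL≡map x [] = refl
  ΦLL≡map x (c ∷ cs) = cong₂ _∷_ (ΦL≡map x c) (ΦLL≡map x cs)

  root-Φ : ∀ x t → root (Φ x t) ≡ root t
  root-Φ x (node y cs) with findR x (concat cs)
  ... | just (node _ []) = root-if (x ≡ᵇ maxL (grandLabels cs))
    where
    root-if : ∀ b → root (if b then node y cs else node y (stepYoung x cs)) ≡ y
    root-if true = refl
    root-if false = refl
  ... | just (node _ ds@(_ ∷ _)) = root-if (x ≡ᵇ maxL (grandLabels cs))
    where
    root-if : ∀ b → root (if b then node y (stepOld x cs ds) else node y cs) ≡ y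
    root-if true = refl
    root-if false = refl
  ... | nothing = refl

  isLeaf-Φ : ∀ x t → isLeaf (Φ x t) ≡ isLeaf t
  isLeaf-Φ x (node y []) = refl
  isLeaf-Φ x (node y cs@(_ ∷ _)) with findR x (concat cs)
  ... | just (node _ []) with x ≡ᵇ maxL (grandLabels cs)
  ...   | true = refl
  ...   | false = refl
  isLeaf-Φ x (node y cs@(_ ∷ _)) | just (node _ (_ ∷ _)) with x ≡ᵇ maxL (grandLabels cs)
  ...   | true = refl
  ...   | false = refl
  isLeaf-Φ x (node y (_ ∷ _)) | nothing = refl

  map-root-Φ : ∀ x ts → map root (map (Φ x) ts) ≡ map root ts
  map-root-Φ x [] = refl
  map-root-Φ x (t ∷ ts) = cong₂ _∷_ (root-Φ x t) (map-root-Φ x ts)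

  grandLabels-Φ : ∀ x cs → grandLabels (map (map (Φ x)) cs) ≡ grandLabels cs
  grandLabels-Φ x cs = trans (cong (map root) (concat-map cs)) (map-root-Φ x (concat cs))

  Φ-absent : ∀ x t → x ∉ labelsT t → Φ x t ≡ t
  ΦLL-absent : ∀ x cs → x ∉ labelsLL cs → ΦLL x cs ≡ cs
  ΦL-absent : ∀ x ts → Every (λ g → x ∉ labelsT g) ts → ΦL x ts ≡ ts

  Φ-absent x (node y cs) x∉ with findR x (concat cs) in eq
  ... | just h with findR-just⁻ x (concat cs) eq
  ...   | h∈ , refl = ⊥-elim (x∉ (there (∈-labelsLL⁺ {cs = cs} h∈ (root∈labelsT h))))
  Φ-absent x (node y cs) x∉ | nothing = cong (node y) (ΦLL-absent x cs (λ m → x∉ (there m)))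

  ΦLL-absent x [] x∉ = refl
  ΦLL-absent x (c ∷ cs) x∉ =
    cong₂ _∷_ (ΦL-absent x c (λ g∈ m → x∉ (∈-++⁺ˡ (∈-labelsL⁺ g∈ m))))
              (ΦLL-absent x cs (λ m → x∉ (∈-++⁺ʳ (labelsL c) m)))

  ΦL-absent x [] x∉ = refl
  ΦL-absent x (t ∷ ts) x∉ = cong₂ _∷_ (Φ-absent x t (x∉ (here refl))) (ΦL-absent x ts (λ g∈ → x∉ (there g∈)))

  map-Φ-absent : ∀ x ts → Every (λ g → x ∉ labelsT g) ts → map (Φ x) ts ≡ ts
  map-Φ-absent x ts x∉ = trans (sym (ΦL≡map x ts)) (ΦL-absent x ts x∉)

  Oint-++ : ∀ a b → Oint (a ++ b) ≡ Oint a ++ Oint b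
  Oint-++ [] b = refl
  Oint-++ (t ∷ a) b = trans (cong (ointT t ++_) (Oint-++ a b)) (sym (++-assoc (ointT t) (Oint a) (Oint b)))

  ∈-Oint⁻ : ∀ ts {z} → z ∈ Oint ts → ∃ λ g → g ∈ ts × z ∈ ointT g
  ∈-Oint⁻ (t ∷ ts) m with ∈-++⁻ (ointT t) m
  ... | inj₁ p = t , here refl , p
  ... | inj₂ p with ∈-Oint⁻ ts p
  ...   | g , g∈ , q = g , there g∈ , q

  ∈-Oint⁺ : ∀ {ts g z} → g ∈ ts → z ∈ ointT g → z ∈ Oint ts
  ∈-Oint⁺ {t ∷ ts} (here refl) m = ∈-++⁺ˡ m
  ∈-Oint⁺ {t ∷ ts} (there g∈) m = ∈-++⁺ʳ (ointT t) (∈-Oint⁺ g∈ m)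

  oldMark : ℕ → Tree → List ℕ
  oldMark m t = if (root t ≡ᵇ m) ∧ not (isLeaf t) then root t ∷ [] else []

  ointL-++ : ∀ m a b → ointL m (a ++ b) ≡ ointL m a ++ ointL m b
  ointL-++ m [] b = refl
  ointL-++ m (t ∷ a) b = begin
    oldMark m t ++ ointT t ++ ointL m (a ++ b)
      ≡⟨ cong (λ w → oldMark m t ++ ointT t ++ w) (ointL-++ m a b) ⟩
    oldMark m t ++ ointT t ++ ointL m a ++ ointL m b
      ≡⟨ cong (oldMark m t ++_) (sym (++-assoc (ointT t) _ _)) ⟩
    oldMark m t ++ (ointT t ++ ointL m a) ++ ointL m b
      ≡⟨ sym (++-assoc (oldMark m t) _ _) ⟩
    (oldMark m t ++ ointT t ++ ointL m a) ++ ointL m b   ∎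
    where open ≡-Reasoning

  ointLL-concat : ∀ m cs → ointLL m cs ≡ ointL m (concat cs)
  ointLL-concat m [] = refl
  ointLL-concat m (c ∷ cs) =
    trans (cong (ointL m c ++_) (ointLL-concat m cs)) (sym (ointL-++ m c (concat cs)))

  OldInternal : ℕ → Tree → Set
  OldInternal m g = root g ≡ m × isLeaf g ≡ false

  ∈-ointL⁻ : ∀ m ts {z} → z ∈ ointL m ts →
    (∃ λ g → g ∈ ts × z ≡ root g × OldInternal m g) ⊎ (∃ λ g → g ∈ ts × z ∈ ointT g)
  ∈-ointL⁻ m (t ∷ ts) z∈ with ∈-++⁻ (oldMark m t) z∈
  ... | inj₁ p with ∈-if-[ (root t ≡ᵇ m) ∧ not (isLeaf t) ]⁻ p
  ...   | tb , refl with T-∧-not⁻ (root t ≡ᵇ m) (isLeaf t) tb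
  ...     | r , l = inj₁ (t , here refl , refl , ≡ᵇ⇒≡ (root t) m r , l)
  ∈-ointL⁻ m (t ∷ ts) z∈ | inj₂ p with ∈-++⁻ (ointT t) p
  ...   | inj₁ q = inj₂ (t , here refl , q)
  ...   | inj₂ q with ∈-ointL⁻ m ts q
  ...     | inj₁ (g , g∈ , w) = inj₁ (g , there g∈ , w)
  ...     | inj₂ (g , g∈ , w) = inj₂ (g , there g∈ , w)

  old∈ointL : ∀ m {ts g} → g ∈ ts → OldInternal m g → root g ∈ ointL m ts
  old∈ointL m {t ∷ ts} (here refl) (r , l) rewrite ≡⇒≡ᵇ-true r | l = here refl
  old∈ointL m {t ∷ ts} (there g∈) old = ∈-++⁺ʳ (oldMark m t) (∈-++⁺ʳ (ointT t) (old∈ointL m g∈ old))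

  inner∈ointL : ∀ m {ts g z} → g ∈ ts → z ∈ ointT g → z ∈ ointL m ts
  inner∈ointL m {t ∷ ts} (here refl) z∈ = ∈-++⁺ʳ (oldMark m t) (∈-++⁺ˡ z∈)
  inner∈ointL m {t ∷ ts} (there g∈) z∈ = ∈-++⁺ʳ (oldMark m t) (∈-++⁺ʳ (ointT t) (inner∈ointL m g∈ z∈))

  ∈-ointT⁻ : ∀ y cs {z} → z ∈ ointT (node y cs) →
    (∃ λ g → g ∈ concat cs × z ≡ root g × OldInternal (maxL (grandLabels cs)) g)
    ⊎ (∃ λ g → g ∈ concat cs × z ∈ ointT g)
  ∈-ointT⁻ y cs z∈ = ∈-ointL⁻ _ (concat cs) (subst (_ ∈_) (ointLL-concat _ cs) z∈)

  old∈ointT : ∀ y cs {g} → g ∈ concat cs → OldInternal (maxL (grandLabels cs)) g → root g ∈ ointT (node y cs)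
  old∈ointT y cs g∈ old = subst (_ ∈_) (sym (ointLL-concat _ cs)) (old∈ointL _ g∈ old)

  inner∈ointT : ∀ y cs {g z} → g ∈ concat cs → z ∈ ointT g → z ∈ ointT (node y cs)
  inner∈ointT y cs g∈ z∈ = subst (_ ∈_) (sym (ointLL-concat _ cs)) (inner∈ointL _ g∈ z∈)

  ointT⊆labels : ∀ t {z} → z ∈ ointT t → z ∈ labelsLL (kids t)
  ointLL⊆labels : ∀ m cs {z} → z ∈ ointLL m cs → z ∈ labelsLL cs
  ointL⊆labels : ∀ m ts {z} → z ∈ ointL m ts → z ∈ labelsL ts
  ointT⊆labels (node y cs) z∈ = ointLL⊆labels _ cs z∈
  ointLL⊆labels m (c ∷ cs) z∈ with ∈-++⁻ (ointL m c) z∈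
  ... | inj₁ p = ∈-++⁺ˡ (ointL⊆labels m c p)
  ... | inj₂ p = ∈-++⁺ʳ (labelsL c) (ointLL⊆labels m cs p)
  ointL⊆labels m (t ∷ ts) z∈ with ∈-++⁻ (oldMark m t) z∈
  ... | inj₁ p with ∈-if-[ (root t ≡ᵇ m) ∧ not (isLeaf t) ]⁻ p
  ...   | _ , refl = ∈-++⁺ˡ (root∈labelsT t)
  ointL⊆labels m (t ∷ ts) z∈ | inj₂ p with ∈-++⁻ (ointT t) p
  ...   | inj₁ q = ∈-++⁺ˡ (kids⊆labelsT t (ointT⊆labels t q))
  ...   | inj₂ q = ∈-++⁺ʳ (labelsT t) (ointL⊆labels m ts q)

  Oint⊆labelsL : ∀ ts {z} → z ∈ Oint ts → z ∈ labelsL ts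
  Oint⊆labelsL ts z∈ with ∈-Oint⁻ ts z∈
  ... | g , g∈ , z∈g = ∈-labelsL⁺ g∈ (kids⊆labelsT g (ointT⊆labels g z∈g))

  Unique-grandchildren : ∀ y cs → Unique (labelsT (node y cs)) → Unique (labelsL (concat cs))
  Unique-grandchildren y cs (_ ∷ u) = subst Unique (labelsLL-concat cs) u

  Unique-++ˡ : ∀ a {b} → Unique (labelsL (a ++ b)) → Unique (labelsL a)
  Unique-++ˡ a {b} u = proj₁ (Unique-++⁻ (labelsL a) (subst Unique (labelsL-++ a b) u))

  Unique-++ʳ : ∀ a {b} → Unique (labelsL (a ++ b)) → Unique (labelsL b)
  Unique-++ʳ a {b} u = proj₁ (proj₂ (Unique-++⁻ (labelsL a) (subst Unique (labelsL-++ a b) u)))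

  Unique-++-disjoint : ∀ a {b} → Unique (labelsL (a ++ b)) →
    ∀ {x} → x ∈ labelsL a → Every (λ g → x ∉ labelsT g) b
  Unique-++-disjoint a {b} u xa g∈ xg =
    proj₂ (proj₂ (Unique-++⁻ (labelsL a) (subst Unique (labelsL-++ a b) u))) xa (∈-labelsL⁺ g∈ xg)

  Unique-++-disjoint′ : ∀ a {b} → Unique (labelsL (a ++ b)) →
    ∀ {x} → x ∈ labelsL b → Every (λ g → x ∉ labelsT g) a
  Unique-++-disjoint′ a {b} u xb g∈ xg =
    proj₂ (proj₂ (Unique-++⁻ (labelsL a) (subst Unique (labelsL-++ a b) u))) (∈-labelsL⁺ g∈ xg) xb

  Unique-member : ∀ ts {g} → Unique (labelsL ts) → g ∈ ts → Unique (labelsT g)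
  Unique-member (t ∷ ts) u (here refl) = proj₁ (Unique-++⁻ (labelsT t) u)
  Unique-member (t ∷ ts) u (there g∈) = Unique-member ts (Unique-++ʳ (t ∷ []) {ts} u) g∈

  Unique-owner : ∀ ts {g h z} → Unique (labelsL ts) → g ∈ ts → h ∈ ts → z ∈ labelsT g → z ∈ labelsT h → g ≡ h
  Unique-owner (t ∷ ts) u (here refl) (here refl) _ _ = refl
  Unique-owner (t ∷ ts) u (here refl) (there h∈) zg zh =
    ⊥-elim (proj₂ (proj₂ (Unique-++⁻ (labelsT t) u)) zg (∈-labelsL⁺ h∈ zh))
  Unique-owner (t ∷ ts) u (there g∈) (here refl) zg zh =
    ⊥-elim (proj₂ (proj₂ (Unique-++⁻ (labelsT t) u)) zh (∈-labelsL⁺ g∈ zg))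
  Unique-owner (t ∷ ts) u (there g∈) (there h∈) zg zh =
    Unique-owner ts (proj₁ (proj₂ (Unique-++⁻ (labelsT t) u))) g∈ h∈ zg zh

  Unique-roots : ∀ ts → Unique (labelsL ts) → Unique (map root ts)
  Unique-roots [] u = []
  Unique-roots (t ∷ ts) u with Unique-++⁻ (labelsT t) u
  ... | _ , u-ts , disjoint = All.tabulate t≢ ∷ Unique-roots ts u-ts
    where
    t≢ : ∀ {w} → w ∈ map root ts → root t ≢ w
    t≢ w∈ refl with ∈-map⁻ root w∈
    ... | g , g∈ , e = disjoint (root∈labelsT t) (subst (_∈ labelsL ts) (sym e) (∈-labelsL⁺ g∈ (root∈labelsT g)))

  ValidAbove : ℕ → ℕ → Tree → Set
  ValidAbove k y g = T (y <ᵇ root g) × T (okT k g)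

  SortedRoots : List Tree → Set
  SortedRoots c = T (increasing (map root c))

  okL⁻ : ∀ k y ts → T (okL k y ts) → Every (ValidAbove k y) ts
  okL⁻ k y (t ∷ ts) ok (here refl) = T-∧⁻ˡ (y <ᵇ root t) ok , T-∧⁻ˡ (okT k t) (T-∧⁻ʳ (y <ᵇ root t) ok)
  okL⁻ k y (t ∷ ts) ok (there g∈) = okL⁻ k y ts (T-∧⁻ʳ (okT k t) (T-∧⁻ʳ (y <ᵇ root t) ok)) g∈

  okL⁺ : ∀ k y ts → Every (ValidAbove k y) ts → T (okL k y ts)
  okL⁺ k y [] _ = tt
  okL⁺ k y (t ∷ ts) v =
    T-∧⁺ (proj₁ (v (here refl))) (T-∧⁺ (proj₂ (v (here refl))) (okL⁺ k y ts (λ g∈ → v (there g∈))))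

  okLL⁻ : ∀ k y cs → T (okLL k y cs) → All SortedRoots cs × Every (ValidAbove k y) (concat cs)
  okLL⁻ k y [] _ = [] , λ ()
  okLL⁻ k y (c ∷ cs) ok with okLL⁻ k y cs (T-∧⁻ʳ (okL k y c) (T-∧⁻ʳ (increasing (map root c)) ok))
  ... | sorted , valid = T-∧⁻ˡ (increasing (map root c)) ok ∷ sorted ,
                         Every-++ c (okL⁻ k y c (T-∧⁻ˡ (okL k y c) (T-∧⁻ʳ (increasing (map root c)) ok))) valid

  okLL⁺ : ∀ k y cs → All SortedRoots cs → Every (ValidAbove k y) (concat cs) → T (okLL k y cs)
  okLL⁺ k y [] _ _ = tt
  okLL⁺ k y (c ∷ cs) (s ∷ ss) v =
    T-∧⁺ s (T-∧⁺ (okL⁺ k y c (λ g∈ → v (∈-++⁺ˡ g∈))) (okLL⁺ k y cs ss (λ g∈ → v (∈-++⁺ʳ c g∈))))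

  okT⁻ : ∀ k y cs → T (okT k (node y cs)) →
    T (prunedShape k cs) × All SortedRoots cs × Every (ValidAbove k y) (concat cs)
  okT⁻ k y cs ok = T-∧⁻ˡ (prunedShape k cs) ok , okLL⁻ k y cs (T-∧⁻ʳ (prunedShape k cs) ok)

  okT⁺ : ∀ k y cs → T (prunedShape k cs) → All SortedRoots cs → Every (ValidAbove k y) (concat cs) →
    T (okT k (node y cs))
  okT⁺ k y cs p s v = T-∧⁺ p (okLL⁺ k y cs s v)

  prunedShape-length : ∀ k c cs → T (prunedShape k (c ∷ cs)) → length (c ∷ cs) ≡ k
  prunedShape-length k c cs p = ≡ᵇ⇒≡ _ k (T-∧⁻ˡ (length (c ∷ cs) ≡ᵇ k) p)

  some-nonnull⇒∈concat : ∀ (cs : List (List Tree)) → T (or (map (λ c → not (null c)) cs)) → ∃ λ g → g ∈ concat cs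
  some-nonnull⇒∈concat ([] ∷ cs) p = some-nonnull⇒∈concat cs p
  some-nonnull⇒∈concat ((g ∷ _) ∷ cs) p = g , here refl

  ∈concat⇒some-nonnull : ∀ (cs : List (List Tree)) {g} → g ∈ concat cs → T (or (map (λ c → not (null c)) cs))
  ∈concat⇒some-nonnull ([] ∷ cs) g∈ = ∈concat⇒some-nonnull cs g∈
  ∈concat⇒some-nonnull ((_ ∷ _) ∷ cs) g∈ = tt

  prunedShape-∃ : ∀ k c cs → T (prunedShape k (c ∷ cs)) → ∃ λ g → g ∈ concat (c ∷ cs)
  prunedShape-∃ k c cs p = some-nonnull⇒∈concat (c ∷ cs) (T-∧⁻ʳ (length (c ∷ cs) ≡ᵇ k) p)

  prunedShape-map : ∀ k (f : Tree → Tree) cs → prunedShape k (map (map f) cs) ≡ prunedShape k cs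
  prunedShape-map k f [] = refl
  prunedShape-map k f (c ∷ cs) =
    cong₂ _∧_ (cong (_≡ᵇ k) (length-map (map f) (c ∷ cs))) (cong or (nonnull-map (c ∷ cs)))
    where
    nonnull-map : ∀ cs → map (λ c → not (null c)) (map (map f) cs) ≡ map (λ c → not (null c)) cs
    nonnull-map [] = refl
    nonnull-map ([] ∷ cs) = cong (_ ∷_) (nonnull-map cs)
    nonnull-map ((_ ∷ _) ∷ cs) = cong (_ ∷_) (nonnull-map cs)

  SortedRoots-Φ : ∀ x cs → All SortedRoots cs → All SortedRoots (map (map (Φ x)) cs)
  SortedRoots-Φ x [] [] = []
  SortedRoots-Φ x (c ∷ cs) (s ∷ ss) =
    subst (λ w → T (increasing w)) (sym (map-root-Φ x c)) s ∷ SortedRoots-Φ x cs ss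

  insertR-↭ : ∀ t ts → insertR t ts ↭ t ∷ ts
  insertR-↭ t [] = ↭-refl
  insertR-↭ t (u ∷ us) with root t ≤ᵇ root u
  ... | true = ↭-refl
  ... | false = ↭-trans (↭-prep u (insertR-↭ t us)) (Perm.swap u t ↭-refl)

  sortR-↭ : ∀ ts → sortR ts ↭ ts
  sortR-↭ [] = ↭-refl
  sortR-↭ (t ∷ ts) = ↭-trans (insertR-↭ t (sortR ts)) (↭-prep t (sortR-↭ ts))

  AllPairs<⇒increasing : ∀ xs → AllPairs _<_ xs → T (increasing xs)
  AllPairs<⇒increasing [] _ = tt
  AllPairs<⇒increasing (x ∷ []) _ = tt
  AllPairs<⇒increasing (x ∷ y ∷ ys) ((x<y ∷ _) ∷ ap) = T-∧⁺ (<⇒<ᵇ x<y) (AllPairs<⇒increasing (y ∷ ys) ap)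

  insertR-AllPairs : ∀ t ts → root t ∉ map root ts → AllPairs _<_ (map root ts) →
    AllPairs _<_ (map root (insertR t ts))
  insertR-AllPairs t [] _ _ = [] ∷ []
  insertR-AllPairs t (u ∷ us) t∉ (u< ∷ ap) with root t ≤ᵇ root u in e
  ... | true = (t<u ∷ All.map (<-trans t<u) u<) ∷ u< ∷ ap
    where
    t<u : root t < root u
    t<u = ≤∧≢⇒< (≤ᵇ⇒≤ (root t) (root u) (subst T (sym e) tt)) (λ q → t∉ (here q))
  ... | false = Perm.All-resp-↭ (↭-sym (Perm.map⁺ root (insertR-↭ t us))) (u<t ∷ u<)
                ∷ insertR-AllPairs t us (λ m → t∉ (there m)) ap
    where
    u<t : root u < root t
    u<t = ≰⇒> (λ le → subst T e (≤⇒≤ᵇ le))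

  sortR-AllPairs : ∀ ts → Unique (map root ts) → AllPairs _<_ (map root (sortR ts))
  sortR-AllPairs [] _ = []
  sortR-AllPairs (t ∷ ts) (t∉ ∷ u) =
    insertR-AllPairs t (sortR ts)
      (λ m → All.lookup t∉ (Perm.∈-resp-↭ (Perm.map⁺ root (sortR-↭ ts)) m) refl)
      (sortR-AllPairs ts u)

  sortR-sorted : ∀ ts → Unique (map root ts) → SortedRoots (sortR ts)
  sortR-sorted ts u = AllPairs<⇒increasing _ (sortR-AllPairs ts u)

  mergeWith : (Tree → Tree) → List Tree → List Tree → List Tree
  mergeWith f μ ν = sortR (map f μ ++ ν)

  concat-zipWith-mergeWith-↭ : ∀ f cs ds → length cs ≡ length ds →
    concat (zipWith (mergeWith f) cs ds) ↭ map f (concat cs) ++ concat ds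
  concat-zipWith-mergeWith-↭ f [] [] _ = ↭-refl
  concat-zipWith-mergeWith-↭ f (c ∷ cs) (d ∷ ds) e = begin
    mergeWith f c d ++ Z                       ↭⟨ Perm.++⁺ʳ Z (sortR-↭ (map f c ++ d)) ⟩
    (map f c ++ d) ++ Z                        ≡⟨ ++-assoc (map f c) d Z ⟩
    map f c ++ d ++ Z                          ↭⟨ Perm.++⁺ˡ (map f c) (Perm.++⁺ˡ d
                                                   (concat-zipWith-mergeWith-↭ f cs ds (suc-injective e))) ⟩
    map f c ++ d ++ map f (concat cs) ++ concat ds   ↭⟨ Perm.++⁺ˡ (map f c) (Perm.shifts d (map f (concat cs))) ⟩
    map f c ++ map f (concat cs) ++ d ++ concat ds   ≡⟨ sym (++-assoc (map f c) _ _) ⟩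
    (map f c ++ map f (concat cs)) ++ d ++ concat ds ≡⟨ cong (_++ _) (sym (map-++ f c (concat cs))) ⟩
    map f (concat (c ∷ cs)) ++ concat (d ∷ ds)       ∎
    where
    open Perm.PermutationReasoning
    Z = concat (zipWith (mergeWith f) cs ds)

  length-zipWith-mergeWith : ∀ f cs ds → length cs ≡ length ds →
    length (zipWith (mergeWith f) cs ds) ≡ length cs
  length-zipWith-mergeWith f [] [] _ = refl
  length-zipWith-mergeWith f (c ∷ cs) (d ∷ ds) e = cong suc (length-zipWith-mergeWith f cs ds (suc-injective e))

  ∈-take-zipWith-mergeWith : ∀ f j cs ds → length cs ≡ length ds → ∀ {e} →
    e ∈ concat (take j cs) → f e ∈ concat (take j (zipWith (mergeWith f) cs ds))
  ∈-take-zipWith-mergeWith f (suc j) (c ∷ cs) (d ∷ ds) le e∈ with ∈-++⁻ c e∈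
  ... | inj₁ p = ∈-++⁺ˡ (Perm.∈-resp-↭ (↭-sym (sortR-↭ (map f c ++ d))) (∈-++⁺ˡ (∈-map⁺ f p)))
  ... | inj₂ p = ∈-++⁺ʳ (mergeWith f c d) (∈-take-zipWith-mergeWith f j cs ds (suc-injective le) p)

  ∈-concat-take⁻ : ∀ j (cs : List (List Tree)) {e} → e ∈ concat (take j cs) → e ∈ concat cs
  ∈-concat-take⁻ (suc j) (c ∷ cs) e∈ with ∈-++⁻ c e∈
  ... | inj₁ p = ∈-++⁺ˡ p
  ... | inj₂ p = ∈-++⁺ʳ c (∈-concat-take⁻ j cs p)

  zipWith-mergeWith-sorted : ∀ f cs ds → Unique (map root (concat (zipWith (mergeWith f) cs ds))) →
    All SortedRoots (zipWith (mergeWith f) cs ds)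
  zipWith-mergeWith-sorted f [] ds u = []
  zipWith-mergeWith-sorted f (c ∷ cs) [] u = []
  zipWith-mergeWith-sorted f (c ∷ cs) (d ∷ ds) u
    with Unique-++⁻ (map root (mergeWith f c d)) (subst Unique (map-++ root (mergeWith f c d) _) u)
  ... | u₁ , u₂ , _ =
    sortR-sorted (map f c ++ d) (Unique-resp-↭ (Perm.map⁺ root (sortR-↭ (map f c ++ d))) u₁)
    ∷ zipWith-mergeWith-sorted f cs ds u₂

  -- stepOld x is zipWith (mergeWith (cut x)): the subtree of x is replaced by the leaf x
  cut : ℕ → Tree → Tree
  cut x t = if root t ≡ᵇ x then node x [] else t

  root-cut : ∀ x t → root (cut x t) ≡ root t
  root-cut x t with root t ≡ᵇ x in e
  ... | true = sym (≡ᵇ-true⇒≡ e)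
  ... | false = refl

  cut-≢ : ∀ x t → root t ≢ x → cut x t ≡ t
  cut-≢ x t ne rewrite ≢⇒≡ᵇ-false ne = refl

  cut-≡ : ∀ x ds → cut x (node x ds) ≡ node x []
  cut-≡ x ds rewrite ≡⇒≡ᵇ-true {x} {x} refl = refl

  cut-cases : ∀ x t → (cut x t ≡ node x [] × root t ≡ x) ⊎ cut x t ≡ t
  cut-cases x t with root t ≡ᵇ x in e
  ... | true = inj₁ (refl , ≡ᵇ-true⇒≡ e)
  ... | false = inj₂ refl

  map-cut-≢ : ∀ x ts → Every (λ g → root g ≢ x) ts → map (cut x) ts ≡ ts
  map-cut-≢ x [] _ = refl
  map-cut-≢ x (t ∷ ts) h = cong₂ _∷_ (cut-≢ x t (h (here refl))) (map-cut-≢ x ts (λ g∈ → h (there g∈)))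

  map-root-cut : ∀ x ts → map root (map (cut x) ts) ≡ map root ts
  map-root-cut x [] = refl
  map-root-cut x (t ∷ ts) = cong₂ _∷_ (root-cut x t) (map-root-cut x ts)

  labelsL-cut-↭ : ∀ x A ds B →
    labelsL ((A ++ node x [] ∷ B) ++ concat ds) ↭ labelsL (A ++ node x ds ∷ B)
  labelsL-cut-↭ x A ds B = begin
    labelsL ((A ++ node x [] ∷ B) ++ D)   ≡⟨ trans (labelsL-++ (A ++ _) D) (cong (_++ LD) (labelsL-++ A _)) ⟩
    (LA ++ x ∷ LB) ++ LD                 ≡⟨ ++-assoc LA (x ∷ LB) LD ⟩
    LA ++ x ∷ LB ++ LD                   ↭⟨ Perm.++⁺ˡ LA (↭-prep x (Perm.++-comm LB LD)) ⟩
    LA ++ x ∷ LD ++ LB                   ≡⟨ cong (λ w → LA ++ x ∷ w ++ LB) (sym (labelsLL-concat ds)) ⟩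
    LA ++ labelsT (node x ds) ++ LB      ≡⟨ sym (labelsL-++ A (node x ds ∷ B)) ⟩
    labelsL (A ++ node x ds ∷ B)         ∎
    where
    open Perm.PermutationReasoning
    D = concat ds
    LA = labelsL A
    LB = labelsL B
    LD = labelsL D

  lleafL-cut : ∀ x A d ds B →
    lleafL ((A ++ node x [] ∷ B) ++ concat (d ∷ ds)) ≡ suc (lleafL (A ++ node x (d ∷ ds) ∷ B))
  lleafL-cut x A d ds B = begin
    lleafL ((A ++ node x [] ∷ B) ++ D)
      ≡⟨ trans (lleafL-++ (A ++ _) D) (cong (_+ lleafL D) (lleafL-++ A _)) ⟩
    lleafL A + (1 + lleafL B) + lleafL D
      ≡⟨ solve ⟩
    suc (lleafL A + (lleafL D + lleafL B))
      ≡⟨ cong (λ w → suc (lleafL A + (w + lleafL B))) (sym (lleafLL-concat (d ∷ ds))) ⟩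
    suc (lleafL A + (lleafT (node x (d ∷ ds)) + lleafL B))
      ≡⟨ cong suc (sym (lleafL-++ A (node x (d ∷ ds) ∷ B))) ⟩
    suc (lleafL (A ++ node x (d ∷ ds) ∷ B))
      ∎
    where
    open ≡-Reasoning
    D = concat (d ∷ ds)
    solve : lleafL A + (1 + lleafL B) + lleafL D ≡ suc (lleafL A + (lleafL D + lleafL B))
    solve = trans (cong (_+ lleafL D) (+-suc (lleafL A) (lleafL B)))
                  (cong suc (trans (+-assoc (lleafL A) _ _) (cong (lleafL A +_) (+-comm (lleafL B) _))))

  oint-grandchild-is-old : ∀ x y cs ds → Unique (labelsT (node y cs)) → node x ds ∈ concat cs →
    x ∈ ointT (node y cs) → OldInternal (maxL (grandLabels cs)) (node x ds)
  oint-grandchild-is-old x y cs ds u v∈ x∈ with ∈-ointT⁻ y cs x∈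
  ... | inj₁ (g , g∈ , x≡ , old)
    with Unique-owner (concat cs) uG g∈ v∈ (subst (_∈ labelsT g) (sym x≡) (root∈labelsT g)) (here refl)
    where uG = Unique-grandchildren y cs u
  ...   | refl = old
  oint-grandchild-is-old x y cs ds u v∈ x∈ | inj₂ (g , g∈ , x∈g)
    with Unique-owner (concat cs) uG g∈ v∈ (kids⊆labelsT g (ointT⊆labels g x∈g)) (here refl)
       | Unique-member (concat cs) uG v∈
    where uG = Unique-grandchildren y cs u
  ... | refl | x∉ ∷ _ = ⊥-elim (All.lookup x∉ (ointT⊆labels g x∈g) refl)

  data ΦView (x y : ℕ) (cs : List (List Tree)) : Tree → Set where
    deeper     : findR x (concat cs) ≡ nothing → ΦView x y cs (node y (map (map (Φ x)) cs))
    grandchild : ∀ d ds → node x (d ∷ ds) ∈ concat cs → x ≡ maxL (grandLabels cs) →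
             ΦView x y cs (node y (stepOld x cs (d ∷ ds)))

  viewΦ : ∀ x y cs → Unique (labelsT (node y cs)) → x ∈ ointT (node y cs) →
    ΦView x y cs (Φ x (node y cs))
  viewΦ x y cs u x∈ with findR x (concat cs) in eq
  ... | nothing = subst (ΦView x y cs ∘ node y) (sym (ΦLL≡map x cs)) (deeper eq)
  ... | just h with findR-just⁻ x (concat cs) eq
  viewΦ x y cs u x∈ | just (node x []) | v∈ , refl
    with oint-grandchild-is-old x y cs [] u v∈ x∈
  ... | _ , ()
  viewΦ x y cs u x∈ | just (node x (d ∷ ds)) | v∈ , refl
    with oint-grandchild-is-old x y cs (d ∷ ds) u v∈ x∈
  ... | x≡max , _ rewrite ≡⇒≡ᵇ-true x≡max = grandchild d ds v∈ x≡max

  record TopContraction (k x y : ℕ) (cs ds : List (List Tree)) : Set where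
    field
      length≡  : length cs ≡ length ds
      length≡k : length cs ≡ k
      merged↭  : concat (stepOld x cs ds) ↭ map (cut x) (concat cs) ++ concat ds
      valid-cs : Every (ValidAbove k y) (concat cs)
      valid-ds : Every (ValidAbove k x) (concat ds)
      y<x      : T (y <ᵇ x)
      max≡     : maxL (grandLabels (stepOld x cs ds)) ≡ maxL (map root (concat ds))
      x<max    : x < maxL (grandLabels (stepOld x cs ds))
      leaf-x∈  : node x [] ∈ concat (stepOld x cs ds)

    ∈-kept : ∀ {g} → g ∈ concat cs → root g ≢ x → g ∈ concat (stepOld x cs ds)
    ∈-kept {g} g∈ g≢x =
      Perm.∈-resp-↭ (↭-sym merged↭) (∈-++⁺ˡ (subst (_∈ _) (cut-≢ x g g≢x) (∈-map⁺ (cut x) g∈)))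

    ∈-moved : ∀ {h} → h ∈ concat ds → h ∈ concat (stepOld x cs ds)
    ∈-moved h∈ = Perm.∈-resp-↭ (↭-sym merged↭) (∈-++⁺ʳ (map (cut x) (concat cs)) h∈)

    valid-merged : Every (ValidAbove k y) (concat (stepOld x cs ds))
    valid-merged {g′} g∈ with ∈-++⁻ (map (cut x) (concat cs)) (Perm.∈-resp-↭ merged↭ g∈)
    ... | inj₂ p = <ᵇ-trans {y} {x} {root g′} y<x (proj₁ (valid-ds p)) , proj₂ (valid-ds p)
    ... | inj₁ p with ∈-map⁻ (cut x) p
    ...   | g , g∈cs , refl with cut-cases x g
    ...     | inj₁ (e , _) rewrite e = y<x , tt
    ...     | inj₂ e rewrite e = valid-cs g∈cs

  topContraction : ∀ k x y cs d ds → T (okT k (node y cs)) →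
    node x (d ∷ ds) ∈ concat cs → x ≡ maxL (grandLabels cs) → TopContraction k x y cs (d ∷ ds)
  topContraction k x y (c ∷ cs) d ds ok v∈ x≡max = record
    { length≡  = length≡
    ; length≡k = length-cs
    ; merged↭  = merged↭
    ; valid-cs = valid-cs
    ; valid-ds = valid-ds
    ; y<x      = proj₁ (valid-cs v∈)
    ; max≡     = max≡
    ; x<max    = subst (x <_) (sym max≡) x<maxD
    ; leaf-x∈  = Perm.∈-resp-↭ (↭-sym merged↭)
                   (∈-++⁺ˡ (subst (_∈ map (cut x) G) (cut-≡ x (d ∷ ds)) (∈-map⁺ (cut x) v∈)))
    }
    where
    G = concat (c ∷ cs)
    D = concat (d ∷ ds)
    ok-cs = okT⁻ k y (c ∷ cs) ok
    valid-cs = proj₂ (proj₂ ok-cs)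
    length-cs = prunedShape-length k c cs (proj₁ ok-cs)
    ok-ds = okT⁻ k x (d ∷ ds) (proj₂ (valid-cs v∈))
    valid-ds = proj₂ (proj₂ ok-ds)
    length≡ = trans length-cs (sym (prunedShape-length k d ds (proj₁ ok-ds)))
    merged↭ = concat-zipWith-mergeWith-↭ (cut x) (c ∷ cs) (d ∷ ds) length≡
    some-grandchild = prunedShape-∃ k d ds (proj₁ ok-ds)
    x<maxD : x < maxL (map root D)
    x<maxD = <-≤-trans (<ᵇ⇒< x _ (proj₁ (valid-ds (proj₂ some-grandchild))))
                       (≤-maxL (∈-map⁺ root (proj₂ some-grandchild)))
    max≡ : maxL (grandLabels (stepOld x (c ∷ cs) (d ∷ ds))) ≡ maxL (map root D)
    max≡ = begin
      maxL (grandLabels (stepOld x (c ∷ cs) (d ∷ ds)))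
        ≡⟨ maxL-↭ (Perm.map⁺ root merged↭) ⟩
      maxL (map root (map (cut x) G ++ D))
        ≡⟨ trans (cong maxL (map-++ root (map (cut x) G) D)) (maxL-++ (map root (map (cut x) G)) _) ⟩
      maxL (map root (map (cut x) G)) ⊔ maxL (map root D)
        ≡⟨ cong (λ w → maxL w ⊔ maxL (map root D)) (map-root-cut x G) ⟩
      maxL (map root G) ⊔ maxL (map root D)
        ≡⟨ m≤n⇒m⊔n≡n (subst (_≤ maxL (map root D)) x≡max (<⇒≤ x<maxD)) ⟩
      maxL (map root D) ∎
      where open ≡-Reasoning

  record TreeStep (k x : ℕ) (t t′ : Tree) : Set where
    field
      valid   : T (okT k t′)
      labels↭ : labelsT t′ ↭ labelsT t
      lleaf≡  : lleafT t′ ≡ suc (lleafT t)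
      oint⊆   : ∀ {z} → z ∈ ointT t → z ≢ x → z ∈ ointT t′

  record ListStep (k x y : ℕ) (ts ts′ : List Tree) : Set where
    field
      valid   : Every (ValidAbove k y) ts′
      labels↭ : labelsL ts′ ↭ labelsL ts
      lleaf≡  : lleafL ts′ ≡ suc (lleafL ts)
      oint⊆   : ∀ {z} → z ∈ Oint ts → z ≢ x → z ∈ Oint ts′

  ListStep-++ʳ : ∀ {k x y a a′} b → ListStep k x y a a′ → Every (ValidAbove k y) b →
    ListStep k x y (a ++ b) (a′ ++ b)
  ListStep-++ʳ {a = a} {a′} b R valid-b = record
    { valid = Every-++ a′ (ListStep.valid R) valid-b
    ; labels↭ = subst₂ _↭_ (sym (labelsL-++ a′ b)) (sym (labelsL-++ a b))
                  (Perm.++⁺ʳ (labelsL b) (ListStep.labels↭ R))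
    ; lleaf≡ = trans (lleafL-++ a′ b)
                 (trans (cong (_+ lleafL b) (ListStep.lleaf≡ R)) (cong suc (sym (lleafL-++ a b))))
    ; oint⊆ = λ {z} z∈ z≢x → subst (z ∈_) (sym (Oint-++ a′ b))
                (oint⊆ (∈-++⁻ (Oint a) (subst (z ∈_) (Oint-++ a b) z∈)) z≢x)
    }
    where
    oint⊆ : ∀ {z} → z ∈ Oint a ⊎ z ∈ Oint b → z ≢ _ → z ∈ Oint a′ ++ Oint b
    oint⊆ (inj₁ p) z≢x = ∈-++⁺ˡ (ListStep.oint⊆ R p z≢x)
    oint⊆ (inj₂ p) z≢x = ∈-++⁺ʳ (Oint a′) p

  ListStep-++ˡ : ∀ {k x y a a′} b → Every (ValidAbove k y) b → ListStep k x y a a′ →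
    ListStep k x y (b ++ a) (b ++ a′)
  ListStep-++ˡ {a = a} {a′} b valid-b R = record
    { valid = Every-++ b valid-b (ListStep.valid R)
    ; labels↭ = subst₂ _↭_ (sym (labelsL-++ b a′)) (sym (labelsL-++ b a))
                  (Perm.++⁺ˡ (labelsL b) (ListStep.labels↭ R))
    ; lleaf≡ = trans (lleafL-++ b a′) (trans (cong (lleafL b +_) (ListStep.lleaf≡ R))
                 (trans (+-suc (lleafL b) (lleafL a)) (cong suc (sym (lleafL-++ b a)))))
    ; oint⊆ = λ {z} z∈ z≢x → subst (z ∈_) (sym (Oint-++ b a′))
                (oint⊆ (∈-++⁻ (Oint b) (subst (z ∈_) (Oint-++ b a) z∈)) z≢x)
    }
    where
    oint⊆ : ∀ {z} → z ∈ Oint b ⊎ z ∈ Oint a → z ≢ _ → z ∈ Oint b ++ Oint a′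
    oint⊆ (inj₁ p) z≢x = ∈-++⁺ˡ p
    oint⊆ (inj₂ p) z≢x = ∈-++⁺ʳ (Oint b) (ListStep.oint⊆ R p z≢x)

  TreeStep⇒ListStep : ∀ {k x y t t′} → TreeStep k x t t′ → root t′ ≡ root t → T (y <ᵇ root t) →
    ListStep k x y (t ∷ []) (t′ ∷ [])
  TreeStep⇒ListStep {t = t} {t′} R root≡ y<t = record
    { valid = λ { (here refl) → subst (λ w → T (_ <ᵇ w)) (sym root≡) y<t , TreeStep.valid R }
    ; labels↭ = subst₂ _↭_ (sym (++-identityʳ (labelsT t′))) (sym (++-identityʳ (labelsT t)))
                  (TreeStep.labels↭ R)
    ; lleaf≡ = trans (+-identityʳ (lleafT t′))
                 (trans (TreeStep.lleaf≡ R) (cong suc (sym (+-identityʳ (lleafT t)))))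
    ; oint⊆ = λ {z} z∈ z≢x → subst (z ∈_) (sym (++-identityʳ (ointT t′)))
                               (TreeStep.oint⊆ R (subst (z ∈_) (++-identityʳ (ointT t)) z∈) z≢x)
    }

  map-cut-at : ∀ x ds A B → Unique (labelsL (A ++ node x ds ∷ B)) →
    map (cut x) (A ++ node x ds ∷ B) ≡ A ++ node x [] ∷ B
  map-cut-at x ds A B u =
    trans (map-++ (cut x) A (node x ds ∷ B))
          (cong₂ _++_ (map-cut-≢ x A x∉A) (cong₂ _∷_ (cut-≡ x ds) (map-cut-≢ x B x∉B)))
    where
    x∉A : Every (λ g → root g ≢ x) A
    x∉A g∈ r = Unique-++-disjoint′ A u (here refl) g∈ (subst (_∈ labelsT _) r (root∈labelsT _))
    x∉B : Every (λ g → root g ≢ x) B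
    x∉B g∈ r = Unique-++-disjoint (node x ds ∷ []) (Unique-++ʳ A u) (here refl) g∈
                 (subst (_∈ labelsT _) r (root∈labelsT _))

  stepTop-oint⊆ : ∀ k x y cs d ds → TopContraction k x y cs (d ∷ ds) → Unique (labelsT (node y cs)) →
    node x (d ∷ ds) ∈ concat cs → x ≡ maxL (grandLabels cs) →
    ∀ {z} → z ∈ ointT (node y cs) → z ≢ x → z ∈ ointT (node y (stepOld x cs (d ∷ ds)))
  stepTop-oint⊆ k x y cs d ds P u v∈ x≡max z∈ z≢x with ∈-ointT⁻ y cs z∈
  ... | inj₁ (g , g∈ , z≡ , root≡ , _) = ⊥-elim (z≢x (trans z≡ (trans root≡ (sym x≡max))))
  ... | inj₂ (g , g∈ , z∈g) with root g ≟ x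
  ...   | no g≢x = inner∈ointT y (stepOld x cs (d ∷ ds)) (TopContraction.∈-kept P g∈ g≢x) z∈g
  ...   | yes g≡x with Unique-owner (concat cs) (Unique-grandchildren y cs u) g∈ v∈
                         (subst (_∈ labelsT g) g≡x (root∈labelsT g)) (here refl)
  ...     | refl with ∈-ointT⁻ x (d ∷ ds) z∈g
  ...       | inj₁ (h , h∈ , refl , root≡ , leaf) =
    old∈ointT y (stepOld x cs (d ∷ ds)) (TopContraction.∈-moved P h∈)
              (trans root≡ (sym (TopContraction.max≡ P)) , leaf)
  ...       | inj₂ (h , h∈ , z∈h) = inner∈ointT y (stepOld x cs (d ∷ ds)) (TopContraction.∈-moved P h∈) z∈h

  stepTop : ∀ k x y cs d ds → T (okT k (node y cs)) → Unique (labelsT (node y cs)) →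
    node x (d ∷ ds) ∈ concat cs → x ≡ maxL (grandLabels cs) →
    TreeStep k x (node y cs) (node y (stepOld x cs (d ∷ ds)))
  stepTop k x y [] d ds ok u () x≡max
  stepTop k x y cs@(_ ∷ _) d ds ok u v∈ x≡max = record
    { valid = okT⁺ k y cs′
        (T-∧⁺ (≡⇒≡ᵇ _ k (trans (length-zipWith-mergeWith (cut x) cs (d ∷ ds) length≡) length≡k))
              (∈concat⇒some-nonnull cs′ leaf-x∈))
        (zipWith-mergeWith-sorted (cut x) cs (d ∷ ds) (Unique-roots G′ (Unique-resp-↭ (↭-sym labels↭) uG)))
        valid-merged
    ; labels↭ = ↭-prep y (subst₂ _↭_ (sym (labelsLL-concat cs′)) (sym (labelsLL-concat cs)) labels↭)
    ; lleaf≡ = begin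
        lleafLL cs′                                  ≡⟨ trans (lleafLL-concat cs′) (lleafL-↭ merged↭) ⟩
        lleafL (map (cut x) G ++ concat (d ∷ ds))   ≡⟨ cong (λ w → lleafL (w ++ _)) cut-G ⟩
        lleafL ((A ++ node x [] ∷ B) ++ concat (d ∷ ds)) ≡⟨ lleafL-cut x A d ds B ⟩
        suc (lleafL (A ++ node x (d ∷ ds) ∷ B))      ≡⟨ cong (suc ∘ lleafL) (sym G≡) ⟩
        suc (lleafL G)                               ≡⟨ cong suc (sym (lleafLL-concat cs)) ⟩
        suc (lleafLL cs)                             ∎
    ; oint⊆ = stepTop-oint⊆ k x y cs d ds P u v∈ x≡max
    }
    where
    open ≡-Reasoning
    P = topContraction k x y cs d ds ok v∈ x≡max
    open TopContraction P
    G = concat cs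
    cs′ = stepOld x cs (d ∷ ds)
    G′ = concat cs′
    uG = Unique-grandchildren y cs u
    split = ∈-∃++ v∈
    A = proj₁ split
    B = proj₁ (proj₂ split)
    G≡ : G ≡ A ++ node x (d ∷ ds) ∷ B
    G≡ = proj₂ (proj₂ split)
    cut-G : map (cut x) G ≡ A ++ node x [] ∷ B
    cut-G = trans (cong (map (cut x)) G≡) (map-cut-at x (d ∷ ds) A B (subst (Unique ∘ labelsL) G≡ uG))
    labels↭ : labelsL G′ ↭ labelsL G
    labels↭ = ↭-trans (labelsL-↭ merged↭)
      (subst₂ (λ w w′ → labelsL (w ++ concat (d ∷ ds)) ↭ labelsL w′) (sym cut-G) (sym G≡)
              (labelsL-cut-↭ x A (d ∷ ds) B))

  stepDeeper : ∀ k x y cs → T (okT k (node y cs)) → findR x (concat cs) ≡ nothing → x ∈ ointT (node y cs) →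
    (x ∈ Oint (concat cs) → ListStep k x y (concat cs) (concat (map (map (Φ x)) cs))) →
    TreeStep k x (node y cs) (node y (map (map (Φ x)) cs))
  stepDeeper k x y [] ok eq () step
  stepDeeper k x y cs@(_ ∷ _) ok eq x∈ step = record
    { valid = okT⁺ k y cs′ (subst T (sym (prunedShape-map k (Φ x) cs)) shape)
                (SortedRoots-Φ x cs sorted) (ListStep.valid R)
    ; labels↭ = ↭-prep y (subst₂ _↭_ (sym (labelsLL-concat cs′)) (sym (labelsLL-concat cs))
                                   (ListStep.labels↭ R))
    ; lleaf≡ = trans (lleafLL-concat cs′) (trans (ListStep.lleaf≡ R) (cong suc (sym (lleafLL-concat cs))))
    ; oint⊆ = oint⊆
    }
    where
    cs′ = map (map (Φ x)) cs
    shape = proj₁ (okT⁻ k y cs ok)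
    sorted = proj₁ (proj₂ (okT⁻ k y cs ok))
    x∈deeper : x ∈ Oint (concat cs)
    x∈deeper with ∈-ointT⁻ y cs x∈
    ... | inj₁ (g , g∈ , x≡ , _) = ⊥-elim (findR-nothing⁻ x (concat cs) eq g∈ (sym x≡))
    ... | inj₂ (g , g∈ , x∈g) = ∈-Oint⁺ g∈ x∈g
    R = step x∈deeper
    Φ∈ : ∀ {g} → g ∈ concat cs → Φ x g ∈ concat cs′
    Φ∈ g∈ = subst (_ ∈_) (sym (concat-map cs)) (∈-map⁺ (Φ x) g∈)
    oint⊆ : ∀ {z} → z ∈ ointT (node y cs) → z ≢ x → z ∈ ointT (node y cs′)
    oint⊆ z∈ z≢x with ∈-ointT⁻ y cs z∈
    ... | inj₁ (g , g∈ , refl , root≡ , leaf) =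
      subst (_∈ ointT (node y cs′)) (root-Φ x g)
        (old∈ointT y cs′ (Φ∈ g∈) (trans (root-Φ x g) (trans root≡ (cong maxL (sym (grandLabels-Φ x cs)))) ,
                                 trans (isLeaf-Φ x g) leaf))
    ... | inj₂ (g , g∈ , z∈g) with ∈-Oint⁻ (concat cs′) (ListStep.oint⊆ R (∈-Oint⁺ g∈ z∈g) z≢x)
    ...   | h , h∈ , z∈h = inner∈ointT y cs′ h∈ z∈h

  concat-map-Φ-absent : ∀ x cs → Every (λ g → x ∉ labelsT g) (concat cs) →
    concat (map (map (Φ x)) cs) ≡ concat cs
  concat-map-Φ-absent x cs x∉ = trans (concat-map cs) (map-Φ-absent x (concat cs) x∉)

  oint-head⇒∉tail : ∀ t ts {x} → Unique (labelsL (t ∷ ts)) → x ∈ ointT t → Every (λ g → x ∉ labelsT g) ts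
  oint-head⇒∉tail t ts u x∈t =
    Unique-++-disjoint (t ∷ []) u
      (subst (_ ∈_) (sym (++-identityʳ (labelsT t))) (kids⊆labelsT t (ointT⊆labels t x∈t)))

  Oint-tail⇒∉head : ∀ t ts {x} → Unique (labelsL (t ∷ ts)) → x ∈ Oint ts → x ∉ labelsT t
  Oint-tail⇒∉head t ts u x∈ts = Unique-++-disjoint′ (t ∷ []) {ts} u (Oint⊆labelsL ts x∈ts) (here refl)

  stepT : ∀ k x t → T (okT k t) → Unique (labelsT t) → x ∈ ointT t → TreeStep k x t (Φ x t)
  stepL : ∀ k x y ts → Every (ValidAbove k y) ts → Unique (labelsL ts) → x ∈ Oint ts →
    ListStep k x y ts (map (Φ x) ts)
  stepLL : ∀ k x y cs → Every (ValidAbove k y) (concat cs) → Unique (labelsL (concat cs)) → x ∈ Oint (concat cs) →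
    ListStep k x y (concat cs) (concat (map (map (Φ x)) cs))

  stepT k x (node y cs) ok u x∈ with Φ x (node y cs) | viewΦ x y cs u x∈
  ... | _ | grandchild d ds v∈ x≡max = stepTop k x y cs d ds ok u v∈ x≡max
  ... | _ | deeper eq =
    stepDeeper k x y cs ok eq x∈ (stepLL k x y cs (proj₂ (proj₂ (okT⁻ k y cs ok))) (Unique-grandchildren y cs u))

  stepL k x y (t ∷ ts) valid u x∈ with ∈-++⁻ (ointT t) x∈
  ... | inj₁ x∈t
    rewrite map-Φ-absent x ts (oint-head⇒∉tail t ts u x∈t) =
    ListStep-++ʳ ts
      (TreeStep⇒ListStep (stepT k x t (proj₂ (valid (here refl))) (Unique-member (t ∷ ts) u (here refl)) x∈t)
                         (root-Φ x t) (proj₁ (valid (here refl))))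
      (λ g∈ → valid (there g∈))
  ... | inj₂ x∈ts rewrite Φ-absent x t (Oint-tail⇒∉head t ts u x∈ts) =
    ListStep-++ˡ (t ∷ []) (λ { (here refl) → valid (here refl) })
      (stepL k x y ts (λ g∈ → valid (there g∈)) (Unique-++ʳ (t ∷ []) {ts} u) x∈ts)

  stepLL k x y (c ∷ cs) valid u x∈ with ∈-++⁻ (Oint c) (subst (x ∈_) (Oint-++ c (concat cs)) x∈)
  ... | inj₁ x∈c rewrite concat-map-Φ-absent x cs (Unique-++-disjoint c u (Oint⊆labelsL c x∈c)) =
    ListStep-++ʳ (concat cs) (stepL k x y c (λ g∈ → valid (∈-++⁺ˡ g∈)) (Unique-++ˡ c u) x∈c)
                             (λ g∈ → valid (∈-++⁺ʳ c g∈))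
  ... | inj₂ x∈cs rewrite map-Φ-absent x c (Unique-++-disjoint′ c u (Oint⊆labelsL (concat cs) x∈cs)) =
    ListStep-++ˡ c (λ g∈ → valid (∈-++⁺ˡ g∈))
                   (stepLL k x y cs (λ g∈ → valid (∈-++⁺ʳ c g∈)) (Unique-++ʳ c u) x∈cs)

  leaves : List Tree → List Tree
  leaves = filter (λ g → T? (isLeaf g))

  leaves-Φ : ∀ x ts → leaves (map (Φ x) ts) ≡ map (Φ x) (leaves ts)
  leaves-Φ x [] = refl
  leaves-Φ x (t ∷ ts) rewrite isLeaf-Φ x t with isLeaf t
  ... | true = cong (Φ x t ∷_) (leaves-Φ x ts)
  ... | false = leaves-Φ x ts

  HasYoungLeaf : Tree → Set
  HasYoungLeaf t = ∃ λ g → g ∈ concat (kids t) × isLeaf g ≡ true × root g ≢ maxL (grandLabels (kids t))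

  LowWitness : ℕ → Tree → Set
  LowWitness k t = ∃ λ e → e ∈ concat (take (k ∸ 1) (kids t)) ×
    (∀ {g} → g ∈ concat (kids t) → isLeaf g ≡ true → root g ≢ maxL (grandLabels (kids t)) → root e ≤ root g)

  OldLeafInvariant : ℕ → Maybe ℕ → Tree → Set
  OldLeafInvariant k next t = rOldT k next t ≡ 0 ⊎ HasYoungLeaf t

  removableOld : Maybe ℕ → List ℕ → ℕ → Bool → ℕ
  removableOld next (a ∷ []) m first = if (a ≡ᵇ m) ∧ first ∧ below next then 1 else 0
    where
    below : Maybe ℕ → Bool
    below nothing = true
    below (just b) = a <ᵇ b
  removableOld next _ m first = 0

  rOldT≡removableOld : ∀ k next t → rOldT k next t ≡
    removableOld next (map root (leaves (concat (kids t)))) (maxL (grandLabels (kids t))) (firstLeaves k t)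
  rOldT≡removableOld k nothing t with leaves (concat (kids t))
  ... | [] = refl
  ... | _ ∷ [] = refl
  ... | _ ∷ _ ∷ _ = refl
  rOldT≡removableOld k (just b) t with leaves (concat (kids t))
  ... | [] = refl
  ... | _ ∷ [] = refl
  ... | _ ∷ _ ∷ _ = refl

  removableOld-young : ∀ next l m first a → a ∈ l → a ≢ m → removableOld next l m first ≡ 0
  removableOld-young next (a ∷ []) m first .a (here refl) a≢m rewrite ≢⇒≡ᵇ-false a≢m = refl
  removableOld-young next (a ∷ _ ∷ _) m first a′ _ _ = refl

  HasYoungLeaf⇒rOldT≡0 : ∀ k next t → HasYoungLeaf t → rOldT k next t ≡ 0
  HasYoungLeaf⇒rOldT≡0 k next t (g , g∈ , leaf , young) =
    trans (rOldT≡removableOld k next t) (removableOld-young next _ _ _ (root g) g∈leaves young)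
    where
    g∈leaves = ∈-map⁺ root (∈-filter⁺ (λ g → T? (isLeaf g)) g∈ (subst T (sym leaf) tt))

  OldLeafInvariant⇒rOldT≡0 : ∀ k next t → OldLeafInvariant k next t → rOldT k next t ≡ 0
  OldLeafInvariant⇒rOldT≡0 k next t (inj₁ r) = r
  OldLeafInvariant⇒rOldT≡0 k next t (inj₂ h) = HasYoungLeaf⇒rOldT≡0 k next t h

  firstLeaves-Φ : ∀ k x y cs → firstLeaves k (node y (map (map (Φ x)) cs)) ≡ firstLeaves k (node y cs)
  firstLeaves-Φ k x y cs =
    cong and (trans (cong (map null) (take-map (k ∸ 1) cs)) (null-map-map (take (k ∸ 1) cs)))
    where
    null-map-map : ∀ (l : List (List Tree)) → map null (map (map (Φ x)) l) ≡ map null l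
    null-map-map [] = refl
    null-map-map ([] ∷ l) = cong (true ∷_) (null-map-map l)
    null-map-map ((_ ∷ _) ∷ l) = cong (false ∷_) (null-map-map l)

  rOldT-Φ-deeper : ∀ k next x y cs → rOldT k next (node y (map (map (Φ x)) cs)) ≡ rOldT k next (node y cs)
  rOldT-Φ-deeper k next x y cs = begin
    rOldT k next (node y cs′)
      ≡⟨ rOldT≡removableOld k next (node y cs′) ⟩
    removableOld next (map root (leaves (concat cs′))) (maxL (grandLabels cs′)) (firstLeaves k (node y cs′))
      ≡⟨ cong₃ (removableOld next) leaf-roots (cong maxL (grandLabels-Φ x cs)) (firstLeaves-Φ k x y cs) ⟩
    removableOld next (map root (leaves (concat cs))) (maxL (grandLabels cs)) (firstLeaves k (node y cs))
      ≡⟨ sym (rOldT≡removableOld k next (node y cs)) ⟩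
    rOldT k next (node y cs) ∎
    where
    open ≡-Reasoning
    cs′ = map (map (Φ x)) cs
    cong₃ : ∀ (f : List ℕ → ℕ → Bool → ℕ) {a a′ b b′ c c′} → a ≡ a′ → b ≡ b′ → c ≡ c′ → f a b c ≡ f a′ b′ c′
    cong₃ f refl refl refl = refl
    leaf-roots : map root (leaves (concat cs′)) ≡ map root (leaves (concat cs))
    leaf-roots = trans (cong (map root ∘ leaves) (concat-map cs))
                 (trans (cong (map root) (leaves-Φ x (concat cs))) (map-root-Φ x (leaves (concat cs))))

  ∈-concat⇒and-null≡false : ∀ (l : List (List Tree)) {e} → e ∈ concat l → and (map null l) ≡ false
  ∈-concat⇒and-null≡false ([] ∷ l) e∈ = ∈-concat⇒and-null≡false l e∈
  ∈-concat⇒and-null≡false ((_ ∷ _) ∷ l) e∈ = refl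

  LowWitness⇒¬firstLeaves : ∀ k t → LowWitness k t → firstLeaves k t ≡ false
  LowWitness⇒¬firstLeaves k t (e , e∈ , _) = ∈-concat⇒and-null≡false (take (k ∸ 1) (kids t)) e∈

  and-null-take-map : ∀ (f : List Tree → List Tree) j (l : List (List Tree)) {e} → e ∈ concat (take j l) →
    (∀ μ → e ∈ μ → null (f μ) ≡ false) → and (map null (take j (map f l))) ≡ false
  and-null-take-map f (suc j) (μ ∷ l) e∈ kept with ∈-++⁻ μ e∈
  ... | inj₁ p rewrite kept μ p = refl
  ... | inj₂ p with null (f μ)
  ...   | true = and-null-take-map f j l p kept
  ...   | false = refl

  null-filter≡false : ∀ (p : Tree → Bool) ts {e} → e ∈ ts → p e ≡ true → null (filter (λ t → T? (p t)) ts) ≡ false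
  null-filter≡false p (t ∷ ts) (here refl) pe rewrite pe = refl
  null-filter≡false p (t ∷ ts) (there e∈) pe with p t
  ... | true = refl
  ... | false = null-filter≡false p ts e∈ pe

  null-map≡ : ∀ (f : Tree → Tree) ts → null (map f ts) ≡ null ts
  null-map≡ f [] = refl
  null-map≡ f (_ ∷ _) = refl

  -- Φ of a young leaf a keeps, in each child of the root, the subtrees with root label ≤ a
  not-removable-young : ∀ k y cs → Unique (map root (concat cs)) → LowWitness k (node y cs) →
    ∀ {g} → g ∈ concat cs →
    (isLeaf g ∧ not (root g ≡ᵇ maxL (grandLabels cs)) ∧ firstLeaves k (Φ (root g) (node y cs))) ≡ false
  not-removable-young k y cs u low {node a (_ ∷ _)} g∈ = refl
  not-removable-young k y cs u (e , e∈ , below) {node a []} g∈ with a ≡ᵇ maxL (grandLabels cs) in a≡?max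
  ... | true = refl
  ... | false rewrite findR-root (concat cs) u g∈ | a≡?max =
    and-null-take-map _ (k ∸ 1) cs e∈ λ μ e∈μ →
      trans (null-map≡ _ _)
            (null-filter≡false (λ t → root t ≤ᵇ a) μ e∈μ (≤⇒≤ᵇ-true (below g∈ refl (≡ᵇ-false⇒≢ a≡?max))))

  length-filter-none : ∀ (p : Tree → Bool) ts → Every (λ g → p g ≡ false) ts →
    length (filter (λ g → T? (p g)) ts) ≡ 0
  length-filter-none p [] h = refl
  length-filter-none p (t ∷ ts) h rewrite h (here refl) = length-filter-none p ts (λ g∈ → h (there g∈))

  LowWitness⇒rYoungT≡0 : ∀ k y cs → Unique (map root (concat cs)) → LowWitness k (node y cs) →
    rYoungT k (node y cs) ≡ 0
  LowWitness⇒rYoungT≡0 k y cs u low = length-filter-none _ (concat cs) (not-removable-young k y cs u low)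

  OldLeafInvariant-Φ-deeper : ∀ k x next y cs → OldLeafInvariant k next (node y cs) →
    OldLeafInvariant k next (node y (map (map (Φ x)) cs))
  OldLeafInvariant-Φ-deeper k x next y cs (inj₁ r) = inj₁ (trans (rOldT-Φ-deeper k next x y cs) r)
  OldLeafInvariant-Φ-deeper k x next y cs (inj₂ (g , g∈ , leaf , young)) =
    inj₂ (Φ x g , subst (_ ∈_) (sym (concat-map cs)) (∈-map⁺ (Φ x) g∈) , trans (isLeaf-Φ x g) leaf ,
          λ e → young (trans (sym (root-Φ x g)) (trans e (cong maxL (grandLabels-Φ x cs)))))

  LowWitness-Φ-deeper : ∀ k x y cs → LowWitness k (node y cs) → LowWitness k (node y (map (map (Φ x)) cs))
  LowWitness-Φ-deeper k x y cs (e , e∈ , below) =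
    Φ x e , subst (_ ∈_) (sym take-Φ) (∈-map⁺ (Φ x) e∈) , below′
    where
    take-Φ : concat (take (k ∸ 1) (map (map (Φ x)) cs)) ≡ map (Φ x) (concat (take (k ∸ 1) cs))
    take-Φ = trans (cong concat (take-map (k ∸ 1) cs)) (concat-map (take (k ∸ 1) cs))
    below′ : ∀ {g′} → g′ ∈ concat (map (map (Φ x)) cs) → isLeaf g′ ≡ true →
             root g′ ≢ maxL (grandLabels (map (map (Φ x)) cs)) → root (Φ x e) ≤ root g′
    below′ g′∈ leaf young with ∈-map⁻ (Φ x) (subst (_ ∈_) (concat-map cs) g′∈)
    ... | g , g∈ , refl = subst₂ _≤_ (sym (root-Φ x e)) (sym (root-Φ x g))
          (below g∈ (trans (sym (isLeaf-Φ x g)) leaf)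
                 (λ q → young (trans (root-Φ x g) (trans q (cong maxL (sym (grandLabels-Φ x cs)))))))

  LowWitness-Φ-grandchild : ∀ k x y cs d ds → TopContraction k x y cs (d ∷ ds) → x ≡ maxL (grandLabels cs) →
    LowWitness k (node y cs) → LowWitness k (node y (stepOld x cs (d ∷ ds)))
  LowWitness-Φ-grandchild k x y cs d ds P x≡max (e , e∈ , below) =
    cut x e , ∈-take-zipWith-mergeWith (cut x) (k ∸ 1) cs (d ∷ ds) length≡ e∈ , below′
    where
    open TopContraction P
    e≤x : root e ≤ x
    e≤x = subst (root e ≤_) (sym x≡max) (≤-maxL (∈-map⁺ root (∈-concat-take⁻ (k ∸ 1) cs e∈)))
    below′ : ∀ {g′} → g′ ∈ concat (stepOld x cs (d ∷ ds)) → isLeaf g′ ≡ true →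
             root g′ ≢ maxL (grandLabels (stepOld x cs (d ∷ ds))) → root (cut x e) ≤ root g′
    below′ g′∈ leaf young with ∈-++⁻ (map (cut x) (concat cs)) (Perm.∈-resp-↭ merged↭ g′∈)
    ... | inj₂ p =
      subst (_≤ _) (sym (root-cut x e)) (<⇒≤ (<-≤-trans (s≤s e≤x) (<ᵇ⇒< x _ (proj₁ (valid-ds p)))))
    ... | inj₁ p with ∈-map⁻ (cut x) p
    ...   | g , g∈ , refl with root g ≟ x
    ...     | yes g≡x = subst₂ _≤_ (sym (root-cut x e)) (sym (trans (root-cut x g) g≡x)) e≤x
    ...     | no g≢x rewrite cut-≢ x g g≢x =
      subst (_≤ root g) (sym (root-cut x e)) (below g∈ leaf (λ q → g≢x (trans q (sym x≡max))))

  OldLeafInvariant-Φ : ∀ k x next t → Unique (labelsT t) → T (okT k t) → x ∈ ointT t →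
    OldLeafInvariant k next t → OldLeafInvariant k next (Φ x t)
  OldLeafInvariant-Φ k x next (node y cs) u ok x∈ inv with Φ x (node y cs) | viewΦ x y cs u x∈
  ... | _ | grandchild d ds v∈ x≡max = inj₂ (node x [] , leaf-x∈ , refl , <⇒≢ x<max)
    where open TopContraction (topContraction k x y cs d ds ok v∈ x≡max)
  ... | _ | deeper _ = OldLeafInvariant-Φ-deeper k x next y cs inv

  LowWitness-Φ : ∀ k x t → Unique (labelsT t) → T (okT k t) → x ∈ ointT t →
    LowWitness k t → LowWitness k (Φ x t)
  LowWitness-Φ k x (node y cs) u ok x∈ low with Φ x (node y cs) | viewΦ x y cs u x∈
  ... | _ | grandchild d ds v∈ x≡max =
    LowWitness-Φ-grandchild k x y cs d ds (topContraction k x y cs d ds ok v∈ x≡max) x≡max low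
  ... | _ | deeper _ = LowWitness-Φ-deeper k x y cs low

  record Preserved (k x : ℕ) (t t′ : Tree) : Set where
    field
      valid   : T (okT k t′)
      labels↭ : labelsT t′ ↭ labelsT t
      oint⊆   : ∀ {z} → z ∈ ointT t → z ≢ x → z ∈ ointT t′
      old-inv : ∀ next → OldLeafInvariant k next t → OldLeafInvariant k next t′
      low     : LowWitness k t → LowWitness k t′

  ΦPreserves : ℕ → ℕ → Tree → Set
  ΦPreserves k x t = Preserved k x t (Φ x t)

  ΦPreserves-oint : ∀ k x t → T (okT k t) → Unique (labelsT t) → x ∈ ointT t → ΦPreserves k x t
  ΦPreserves-oint k x t ok u x∈ = record
    { valid = TreeStep.valid R ; labels↭ = TreeStep.labels↭ R ; oint⊆ = TreeStep.oint⊆ R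
    ; old-inv = λ next → OldLeafInvariant-Φ k x next t u ok x∈ ; low = LowWitness-Φ k x t u ok x∈ }
    where R = stepT k x t ok u x∈

  ΦPreserves-absent : ∀ k x t → T (okT k t) → x ∉ labelsT t → ΦPreserves k x t
  ΦPreserves-absent k x t ok x∉ = subst (Preserved k x t) (sym (Φ-absent x t x∉))
    record { valid = ok ; labels↭ = ↭-refl ; oint⊆ = λ z∈ _ → z∈ ; old-inv = λ _ i → i ; low = λ i → i }

  ΦPreserves-forest : ∀ k x F → Every (T ∘ okT k) F → Unique (labelsL F) → x ∈ Oint F →
    Every (ΦPreserves k x) F
  ΦPreserves-forest k x F ok u x∈ {t} t∈ with x ∈? ointT t | ∈-Oint⁻ F x∈
  ... | yes x∈t | _ = ΦPreserves-oint k x t (ok t∈) (Unique-member F u t∈) x∈t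
  ... | no x∉t | t′ , t′∈ , x∈t′ = ΦPreserves-absent k x t (ok t∈) x∉
    where
    x∉ : x ∉ labelsT t
    x∉ x∈labels with Unique-owner F u t∈ t′∈ x∈labels (kids⊆labelsT t′ (ointT⊆labels t′ x∈t′))
    ... | refl = x∉t x∈t′

  lleafL-Φ : ∀ k x F → Every (T ∘ okT k) F → Unique (labelsL F) → x ∈ Oint F →
    lleafL (map (Φ x) F) ≡ suc (lleafL F)
  lleafL-Φ k x (t ∷ ts) ok u x∈ with ∈-++⁻ (ointT t) x∈
  ... | inj₁ x∈t rewrite map-Φ-absent x ts (oint-head⇒∉tail t ts u x∈t) =
    cong (_+ lleafL ts) (TreeStep.lleaf≡ (stepT k x t (ok (here refl)) (Unique-member (t ∷ ts) u (here refl)) x∈t))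
  ... | inj₂ x∈ts rewrite Φ-absent x t (Oint-tail⇒∉head t ts u x∈ts) =
    trans (cong (lleafT t +_) (lleafL-Φ k x ts (λ m → ok (there m)) (Unique-++ʳ (t ∷ []) {ts} u) x∈ts))
          (+-suc (lleafT t) (lleafL ts))

  ForestInvariant : ℕ → Forest → Set
  ForestInvariant k [] = ⊤
  ForestInvariant k (t ∷ []) = OldLeafInvariant k nothing t × LowWitness k t × isLeaf t ≡ false
  ForestInvariant k (t ∷ t′ ∷ ts) = OldLeafInvariant k (just (root t′)) t × ForestInvariant k (t′ ∷ ts)

  ForestInvariant-Φ : ∀ k x F → Every (ΦPreserves k x) F → ForestInvariant k F →
    ForestInvariant k (map (Φ x) F)
  ForestInvariant-Φ k x [] h i = tt
  ForestInvariant-Φ k x (t ∷ []) h (old , low , leaf) =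
    Preserved.old-inv (h (here refl)) nothing old , Preserved.low (h (here refl)) low , trans (isLeaf-Φ x t) leaf
  ForestInvariant-Φ k x (t ∷ t′ ∷ ts) h (old , i) =
    subst (λ w → OldLeafInvariant k (just w) (Φ x t)) (sym (root-Φ x t′))
          (Preserved.old-inv (h (here refl)) _ old) ,
    ForestInvariant-Φ k x (t′ ∷ ts) (λ m → h (there m)) i

  barCond-∷ : ∀ k s t ts → barCond k (s ∷ t ∷ ts) ≡ barCond k (t ∷ ts)
  barCond-∷ k s t ts with lastT (t ∷ ts)
  ... | nothing = refl
  ... | just _ = refl

  rYoung-∷ : ∀ k s t ts → rYoung k (s ∷ t ∷ ts) ≡ rYoung k (t ∷ ts)
  rYoung-∷ k s t ts with lastT (t ∷ ts)
  ... | nothing = refl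
  ... | just _ = refl

  youngMark : ℕ → Tree → List ℕ
  youngMark m t = if not (root t ≡ᵇ m) ∧ isLeaf t then root t ∷ [] else []

  yleafL-++ : ∀ m a b → yleafL m (a ++ b) ≡ yleafL m a ++ yleafL m b
  yleafL-++ m [] b = refl
  yleafL-++ m (t ∷ a) b = begin
    youngMark m t ++ yleafT t ++ yleafL m (a ++ b)
      ≡⟨ cong (λ w → youngMark m t ++ yleafT t ++ w) (yleafL-++ m a b) ⟩
    youngMark m t ++ yleafT t ++ yleafL m a ++ yleafL m b
      ≡⟨ cong (youngMark m t ++_) (sym (++-assoc (yleafT t) _ _)) ⟩
    youngMark m t ++ (yleafT t ++ yleafL m a) ++ yleafL m b
      ≡⟨ sym (++-assoc (youngMark m t) _ _) ⟩
    (youngMark m t ++ yleafT t ++ yleafL m a) ++ yleafL m b ∎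
    where open ≡-Reasoning

  yleafLL-concat : ∀ m cs → yleafLL m cs ≡ yleafL m (concat cs)
  yleafLL-concat m [] = refl
  yleafLL-concat m (c ∷ cs) =
    trans (cong (yleafL m c ++_) (yleafLL-concat m cs)) (sym (yleafL-++ m c (concat cs)))

  young∈yleafL : ∀ m {ts g} → g ∈ ts → isLeaf g ≡ true → root g ≢ m → root g ∈ yleafL m ts
  young∈yleafL m {t ∷ ts} (here refl) leaf young rewrite ≢⇒≡ᵇ-false young | leaf = here refl
  young∈yleafL m {t ∷ ts} (there g∈) leaf young =
    ∈-++⁺ʳ (youngMark m t) (∈-++⁺ʳ (yleafT t) (young∈yleafL m g∈ leaf young))

  and-null≡false⇒∈ : ∀ (l : List (List Tree)) → and (map null l) ≡ false → ∃ λ e → e ∈ concat l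
  and-null≡false⇒∈ ([] ∷ l) p = and-null≡false⇒∈ l p
  and-null≡false⇒∈ ((e ∷ _) ∷ l) p = e , here refl

  -- without young leaves the bound on the witness is vacuous
  LowWitness-init : ∀ k t → yleafT t ≡ [] → firstLeaves k t ≡ false → LowWitness k t
  LowWitness-init k (node y cs) no-young first with and-null≡false⇒∈ (take (k ∸ 1) cs) first
  ... | e , e∈ = e , e∈ , λ {g} g∈ leaf young → ⊥-elim (¬Any[] (subst (root g ∈_) no-young
                   (subst (root g ∈_) (sym (yleafLL-concat _ cs)) (young∈yleafL _ g∈ leaf young))))

  ForestInvariant-init : ∀ k F → Yleaf F ≡ [] → rOld k F ≡ 0 → ¬ T (barCond k F) → ForestInvariant k F
  ForestInvariant-init k [] _ _ _ = tt
  ForestInvariant-init k (t ∷ []) no-young r ¬bar with ¬T-∨⁻ (isLeaf t) (firstLeaves k t) ¬bar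
  ... | leaf , first = inj₁ r , LowWitness-init k t (++-conicalˡ (yleafT t) [] no-young) first , leaf
  ForestInvariant-init k (t ∷ t′ ∷ ts) no-young r ¬bar =
    inj₁ (m+n≡0⇒m≡0 _ r) ,
    ForestInvariant-init k (t′ ∷ ts) (++-conicalʳ (yleafT t) _ no-young)
      (m+n≡0⇒n≡0 (rOldT k (just (root t′)) t) r) (¬bar ∘ subst T (sym (barCond-∷ k t t′ ts)))

  InFhatStar⇒ForestInvariant : ∀ n k F → InFhatStar n k F → ForestInvariant k F
  InFhatStar⇒ForestInvariant n k F ((_ , ¬bar) , no-young , no-removable) =
    ForestInvariant-init k F no-young (m+n≡0⇒m≡0 _ no-removable) ¬bar

  ForestInvariant⇒¬barCond : ∀ k F → ForestInvariant k F → barCond k F ≡ false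
  ForestInvariant⇒¬barCond k [] _ = refl
  ForestInvariant⇒¬barCond k (t ∷ []) (_ , low , leaf) rewrite leaf = LowWitness⇒¬firstLeaves k t low
  ForestInvariant⇒¬barCond k (t ∷ t′ ∷ ts) (_ , i) =
    trans (barCond-∷ k t t′ ts) (ForestInvariant⇒¬barCond k (t′ ∷ ts) i)

  ForestInvariant⇒rOld≡0 : ∀ k F → ForestInvariant k F → rOld k F ≡ 0
  ForestInvariant⇒rOld≡0 k [] _ = refl
  ForestInvariant⇒rOld≡0 k (t ∷ []) (i , _) = OldLeafInvariant⇒rOldT≡0 k nothing t i
  ForestInvariant⇒rOld≡0 k (t ∷ t′ ∷ ts) (i , j) =
    cong₂ _+_ (OldLeafInvariant⇒rOldT≡0 k _ t i) (ForestInvariant⇒rOld≡0 k (t′ ∷ ts) j)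

  ForestInvariant⇒rYoung≡0 : ∀ k F → Every (Unique ∘ labelsT) F → ForestInvariant k F → rYoung k F ≡ 0
  ForestInvariant⇒rYoung≡0 k [] _ _ = refl
  ForestInvariant⇒rYoung≡0 k (node y cs ∷ []) u (_ , low , _) =
    LowWitness⇒rYoungT≡0 k y cs (Unique-roots (concat cs) (Unique-grandchildren y cs (u (here refl)))) low
  ForestInvariant⇒rYoung≡0 k (t ∷ t′ ∷ ts) u (_ , j) =
    trans (rYoung-∷ k t t′ ts) (ForestInvariant⇒rYoung≡0 k (t′ ∷ ts) (λ m → u (there m)) j)

  ForestInvariant⇒rleaf≡0 : ∀ k F → Unique (labelsL F) → ForestInvariant k F → rleaf k F ≡ 0
  ForestInvariant⇒rleaf≡0 k F u inv =
    cong₂ _+_ (ForestInvariant⇒rOld≡0 k F inv) (ForestInvariant⇒rYoung≡0 k F (Unique-member F u) inv)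

  dropLastSingleton : Maybe Tree → List ℕ → List ℕ
  dropLastSingleton nothing s = s
  dropLastSingleton (just (node y [])) s = filter (λ z → T? (not (z ≡ᵇ y))) s
  dropLastSingleton (just (node y (_ ∷ _))) s = s

  SiStar≡dropLastSingleton : ∀ F → SiStar F ≡ dropLastSingleton (lastT F) (Si F)
  SiStar≡dropLastSingleton F with lastT F
  ... | nothing = refl
  ... | just (node y []) = refl
  ... | just (node y (_ ∷ _)) = refl

  lastT-map : ∀ (f : Tree → Tree) F → lastT (map f F) ≡ Maybe.map f (lastT F)
  lastT-map f [] = refl
  lastT-map f (t ∷ []) = refl
  lastT-map f (t ∷ t′ ∷ ts) = lastT-map f (t′ ∷ ts)

  dropLastSingleton-Φ : ∀ x m s → dropLastSingleton (Maybe.map (Φ x) m) s ≡ dropLastSingleton m s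
  dropLastSingleton-Φ x nothing s = refl
  dropLastSingleton-Φ x (just (node y [])) s = refl
  dropLastSingleton-Φ x (just (node y cs@(_ ∷ _))) s with Φ x (node y cs) | isLeaf-Φ x (node y cs)
  ... | node _ (_ ∷ _) | _ = refl

  Si-Φ : ∀ x F → Si (map (Φ x) F) ≡ Si F
  Si-Φ x F = trans (cong (map root) (leaves-Φ x F)) (map-root-Φ x (leaves F))

  si-Φ : ∀ x F → si (map (Φ x) F) ≡ si F
  si-Φ x F = trans (cong length (leaves-Φ x F)) (length-map (Φ x) (leaves F))

  SiStar-Φ : ∀ x F → SiStar (map (Φ x) F) ≡ SiStar F
  SiStar-Φ x F = begin
    SiStar (map (Φ x) F)
      ≡⟨ SiStar≡dropLastSingleton (map (Φ x) F) ⟩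
    dropLastSingleton (lastT (map (Φ x) F)) (Si (map (Φ x) F))
      ≡⟨ cong₂ dropLastSingleton (lastT-map (Φ x) F) (Si-Φ x F) ⟩
    dropLastSingleton (Maybe.map (Φ x) (lastT F)) (Si F)
      ≡⟨ dropLastSingleton-Φ x (lastT F) (Si F) ⟩
    dropLastSingleton (lastT F) (Si F)
      ≡⟨ sym (SiStar≡dropLastSingleton F) ⟩
    SiStar F
      ∎
    where open ≡-Reasoning

  InF⇒Unique : ∀ {n k} G → InF n k G → Unique (labelsL G)
  InF⇒Unique {n} G (_ , _ , labels↭) =
    Unique-resp-↭ (↭-sym (subst (_↭ _) (labelsF≡labelsL G) labels↭))
                  (Unique.map⁺ suc-injective (Unique.upTo⁺ n))

  InF⇒valid : ∀ {n k} G → InF n k G → Every (T ∘ okT k) G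
  InF⇒valid {k = k} G (ok , _) = and⁻ G ok
    where
    and⁻ : ∀ F → T (and (map (okT k) F)) → Every (T ∘ okT k) F
    and⁻ (t ∷ F) p (here refl) = T-∧⁻ˡ (okT k t) p
    and⁻ (t ∷ F) p (there m) = and⁻ F (T-∧⁻ʳ (okT k t) p) m

  InF-Φ : ∀ n k x G → InF n k G → Every (ΦPreserves k x) G → InF n k (ΦF x G)
  InF-Φ n k x G (_ , increasing-roots , labels↭) pres =
    and⁺ G pres , subst (T ∘ increasing) (sym (map-root-Φ x G)) increasing-roots ,
    ↭-trans (subst (_↭ labelsL G) (sym (labelsF≡labelsL (map (Φ x) G)))
                   (labelsL-map-↭ (Φ x) G (Preserved.labels↭ ∘ pres)))
            (subst (_↭ _) (labelsF≡labelsL G) labels↭)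
    where
    and⁺ : ∀ F → Every (ΦPreserves k x) F → T (and (map (okT k) (map (Φ x) F)))
    and⁺ [] _ = tt
    and⁺ (t ∷ F) p = T-∧⁺ (Preserved.valid (p (here refl))) (and⁺ F (λ m → p (there m)))

  Oint-Φ : ∀ k x G → Every (ΦPreserves k x) G → ∀ {z} → z ∈ Oint G → z ≢ x → z ∈ Oint (ΦF x G)
  Oint-Φ k x G pres z∈ z≢x with ∈-Oint⁻ G z∈
  ... | t , t∈ , z∈t = ∈-Oint⁺ (∈-map⁺ (Φ x) t∈) (Preserved.oint⊆ (pres t∈) z∈t z≢x)

  record ΦSOutcome (n k : ℕ) (F G : Forest) (S : List ℕ) : Set where
    field
      inF       : InF n k G
      invariant : ForestInvariant k G
      lleaf≡    : lleaf G ≡ lleaf F + length S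
      si≡       : si G ≡ si F
      SiStar≡   : SiStar G ≡ SiStar F
      oint⊆     : ∀ {z} → z ∈ Oint F → z ∉ S → z ∈ Oint G

  ΦS-outcome : ∀ n k F → InF n k F → ForestInvariant k F →
    ∀ S → Unique S → (∀ x → x ∈ S → x ∈ Oint F) → ΦSOutcome n k F (ΦS S F) S
  ΦS-outcome n k F inF inv [] _ _ = record
    { inF = inF ; invariant = inv ; lleaf≡ = sym (+-identityʳ _)
    ; si≡ = refl ; SiStar≡ = refl ; oint⊆ = λ z∈ _ → z∈ }
  ΦS-outcome n k F inF inv (x ∷ S) (x∉S ∷ uS) S⊆ = record
    { inF = InF-Φ n k x G inF′ pres
    ; invariant = ForestInvariant-Φ k x G pres invariant
    ; lleaf≡ = begin
        lleaf (ΦF x G)           ≡⟨ sym (lleafL≡lleaf (ΦF x G)) ⟩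
        lleafL (ΦF x G)          ≡⟨ lleafL-Φ k x G (InF⇒valid G inF′) (InF⇒Unique G inF′) x∈G ⟩
        suc (lleafL G)           ≡⟨ cong suc (trans (lleafL≡lleaf G) lleaf≡) ⟩
        suc (lleaf F + length S) ≡⟨ sym (+-suc (lleaf F) (length S)) ⟩
        lleaf F + length (x ∷ S) ∎
    ; si≡ = trans (si-Φ x G) si≡
    ; SiStar≡ = trans (SiStar-Φ x G) SiStar≡
    ; oint⊆ = λ z∈ z∉ → Oint-Φ k x G pres (oint⊆ z∈ (z∉ ∘ there)) (z∉ ∘ here)
    }
    where
    open ≡-Reasoning
    G = ΦS S F
    open ΦSOutcome (ΦS-outcome n k F inF inv S uS (λ y y∈ → S⊆ y (there y∈))) renaming (inF to inF′)
    x∈G : x ∈ Oint G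
    x∈G = oint⊆ (S⊆ x (here refl)) (λ x∈S → All.lookup x∉S x∈S refl)
    pres : Every (ΦPreserves k x) G
    pres = ΦPreserves-forest k x G (InF⇒valid G inF′) (InF⇒Unique G inF′) x∈G

  +[a+l]-s≡+a-s++l : ∀ a l s → ℤ.+ (a + l) ℤ.- ℤ.+ s ≡ (ℤ.+ a ℤ.- ℤ.+ s) ℤ.+ ℤ.+ l
  +[a+l]-s≡+a-s++l a l s = begin
    ℤ.+ (a + l) ℤ.- ℤ.+ s           ≡⟨ cong (ℤ._- ℤ.+ s) (ℤ.pos-+ a l) ⟩
    (ℤ.+ a ℤ.+ ℤ.+ l) ℤ.- ℤ.+ s     ≡⟨ ℤ.+-assoc (ℤ.+ a) (ℤ.+ l) (ℤ.- ℤ.+ s) ⟩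
    ℤ.+ a ℤ.+ (ℤ.+ l ℤ.- ℤ.+ s)     ≡⟨ cong (λ w → ℤ.+ a ℤ.+ w) (ℤ.+-comm (ℤ.+ l) (ℤ.- ℤ.+ s)) ⟩
    ℤ.+ a ℤ.+ (ℤ.- ℤ.+ s ℤ.+ ℤ.+ l) ≡⟨ sym (ℤ.+-assoc (ℤ.+ a) (ℤ.- ℤ.+ s) (ℤ.+ l)) ⟩
    (ℤ.+ a ℤ.- ℤ.+ s) ℤ.+ ℤ.+ l     ∎
    where open ≡-Reasoning

open Contraction

open import Defs
open import Data.Nat using (ℕ; _≤_)
open import Data.Integer using (+_; _+_; _-_)
open import Data.List using (List; length)
open import Data.List.Membership.Propositional using (_∈_)
open import Data.List.Relation.Unary.Unique.Propositional using (Unique)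
open import Data.Product using (_×_; _,_; proj₁)
open import Data.Bool using (T)
open import Function.Bundles using (_⇔_; mk⇔)
open import Relation.Binary.PropositionalEquality using (_≡_; subst; sym; trans; cong₂)

lemma5p3 : (n k : ℕ) → 1 ≤ n → 1 ≤ k → (F : Forest) → InFhatStar n k F →
    (S : List ℕ) → Unique S → (∀ x → x ∈ S → x ∈ Oint F) →
    InFhat n k (ΦS S F)
    × rleaf k (ΦS S F) ≡ 0
    × (∀ x → (x ∈ SiStar (ΦS S F)) ⇔ (x ∈ SiStar F))
    × ((+ lleaf (ΦS S F)) - (+ si (ΦS S F)) ≡ ((+ lleaf F) - (+ si F)) + (+ length S))
lemma5p3 n k _ _ F F∈ S uS S⊆ =
  (inF , subst T (ForestInvariant⇒¬barCond k G invariant)) ,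
  ForestInvariant⇒rleaf≡0 k G (InF⇒Unique G inF) invariant ,
  (λ x → mk⇔ (subst (x ∈_) SiStar≡) (subst (x ∈_) (sym SiStar≡))) ,
  trans (cong₂ (λ a b → + a - + b) lleaf≡ si≡) (+[a+l]-s≡+a-s++l (lleaf F) (length S) (si F))
  where
  G = ΦS S F
  open ΦSOutcome (ΦS-outcome n k F (proj₁ (proj₁ F∈)) (InFhatStar⇒ForestInvariant n k F F∈) S uS S⊆)
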